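{- Let $(k,p,q)$ be a type B basic triple and let $n\ge\max\{p+k-1,q+k-1\}$. Then the basic signed permutation $w(k,p,q)\in W_n$ is the unique minimum, in Bruhat order, of the set $\{w\in W_n : r_w(p,q)\ge k\}$; that is, $r_{w(k,p,q)}(p,q)\ge k$, and every $w\in W_n$ with $r_w(p,q)\ge k$ satisfies $w\ge w(k,p,q)$.
   Context: Write $\bar m$ for $-m$. $W_n$ is the group of bijections $w$ of $\{\bar n,\dots,n\}$ with $w(\bar\imath)=\overline{w(i)}$, written $w(1)\cdots w(n)$; $W_N\subseteq W_n$ for $N\le n$ via $w(i)=i$ for $i>N$. $W_n$ carries the Bruhat order of the Weyl group of type $B_n$. Rank function: for $1\le p\le n$, $\bar n\le q\le n$, $r_w(p,q)=\#\{i:p\le i\le n,\ w(i)\le\bar q\}$. Type B basic triple: integers $(k,p,q)$ with $k>\max\{0,1-p-q\}$, $p>0$, $q\ne0$, and $q>0$ if $p=1$. Basic signed permutation $w(k,p,q)$, for $N=\max\{p+k-1,q+k-1\}$: the element of $W_N$ whose entries in positions $p,\dots,p+k-1$ are, in order, $-(q+k-1),\dots,-q$ if $q>0$; $-k,\dots,-(|q|+1),1,\dots,|q|$ if $q<0$ and $k>|q|$; $|q|-k+1,\dots,|q|$ if $q<0$ and $k\le|q|$; the remaining positions $1,\dots,p-1,p+k,\dots,N$ are filled in increasing order by the elements of $\{1,\dots,N\}$ whose absolute value is not already used. -}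

module Defs where

open import Data.Nat as ℕ using (ℕ; zero; suc; _∸_; _⊔_)
open import Data.Integer as ℤ using (ℤ; +_; -[1+_]; -_; ∣_∣)
open import Data.List using (List; []; _∷_; _++_; map; filter; length; reverse; foldl; applyUpTo; take; drop)
open import Data.List.Membership.DecPropositional ℕ._≟_ using (_∈?_)
open import Data.List.Relation.Binary.Permutation.Propositional using (_↭_)
open import Data.Fin using (Fin) renaming (zero to fzero; suc to fsuc)
open import Data.Product using (Σ; _×_; ∃; ∃-syntax)
open import Relation.Nullary using (¬?; ¬_)
import Relation.Nullary
open import Relation.Binary.PropositionalEquality using (_≡_)
open import Relation.Binary.Construct.Closure.ReflexiveTransitive using (Star)

-- Signed permutations in one-line notation: w is represented by the
-- list [w(1), ..., w(n)] of integers.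

range : ℕ → ℕ → List ℕ
range a b = applyUpTo (λ i → a ℕ.+ i) (suc b ∸ a)

-- w ∈ W_n : length n and |w(1)|,...,|w(n)| is a permutation of 1..n
-- (w(ī) = - w(i) is then built in by the one-line representation).
IsSignedPerm : ℕ → List ℤ → Set
IsSignedPerm n w = (length w ≡ n) × (map ∣_∣ w ↭ range 1 n)

identity : ℕ → List ℤ
identity n = map +_ (range 1 n)

-- Coxeter generators of W_n (type B_n): s₀ changes the sign of w(1),
-- s_i (1 ≤ i ≤ n-1) swaps positions i and i+1.  Acting on the right:
-- the one-line notation of w·s is obtained from that of w.

negHead : List ℤ → List ℤ
negHead []       = []
negHead (x ∷ xs) = (- x) ∷ xs

swapAt : ℕ → List ℤ → List ℤ
swapAt zero    (x ∷ y ∷ xs) = y ∷ x ∷ xs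
swapAt zero    xs           = xs
swapAt (suc i) []           = []
swapAt (suc i) (x ∷ xs)     = x ∷ swapAt i xs

act : ∀ {n} → Fin n → List ℤ → List ℤ
act fzero    w = negHead w
act (fsuc i) w = swapAt (Data.Fin.toℕ i) w

mulWord : ∀ {n} → List ℤ → List (Fin n) → List ℤ
mulWord w ws = foldl (λ v s → act s v) w ws

prod : ∀ n → List (Fin n) → List ℤ
prod n ws = mulWord (identity n) ws

HasLength : ∀ n → List ℤ → ℕ → Set
HasLength n x m =
  (∃[ ws ] (prod n ws ≡ x × length ws ≡ m)) ×
  (∀ (ws : List (Fin n)) → prod n ws ≡ x → m ℕ.≤ length ws)

-- x → y : y = x t for a reflection t (a conjugate v s v⁻¹ of a simple
-- reflection s; v⁻¹ is the reversed word) with ℓ(x) < ℓ(y)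
BruhatStep : ∀ n → List ℤ → List ℤ → Set
BruhatStep n x y =
  (∃[ v ] ∃[ s ] (y ≡ mulWord {n} x (v ++ (s ∷ reverse v)))) ×
  (∃[ lx ] ∃[ ly ] (HasLength n x lx × HasLength n y ly × lx ℕ.< ly))

BruhatLe : ℕ → List ℤ → List ℤ → Set
BruhatLe n = Star (BruhatStep n)

rank : List ℤ → ℕ → ℤ → ℕ
rank w p q = length (filter (λ v → v ℤ.≤? (- q)) (drop (p ∸ 1) w))

block : ℕ → ℤ → List ℤ
block k (+ zero)   = []   -- q = 0 is excluded by hypothesis
block k (+ suc m)  = map (λ j → - (+ (suc m ℕ.+ k ∸ 1 ∸ j))) (applyUpTo (λ j → j) k)
    -- -(q+k-1), ..., -q  with q = m+1
block k -[1+ m ] with suc m ℕ.<? k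
... | Relation.Nullary.yes _ = map (λ i → - (+ i)) (reverse (range (suc (suc m)) k)) ++ map +_ (range 1 (suc m))
    -- -k, ..., -(|q|+1), 1, ..., |q|
... | Relation.Nullary.no _  = map +_ (range (suc m ∸ k ℕ.+ 1) (suc m))
    -- |q|-k+1, ..., |q|

bigN : ℕ → ℕ → ℤ → ℕ
bigN k p (+ q)    = (p ℕ.+ k ∸ 1) ⊔ (q ℕ.+ k ∸ 1)
bigN k p -[1+ _ ] = p ℕ.+ k ∸ 1

basicN : ℕ → ℕ → ℤ → List ℤ
basicN k p q = take (p ∸ 1) rest ++ block k q ++ drop (p ∸ 1) rest
  where
    used : List ℕ
    used = map ∣_∣ (block k q)
    rest : List ℤ
    rest = map +_ (filter (λ v → ¬? (v ∈? used)) (range 1 (bigN k p q)))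

basic : ℕ → ℕ → ℕ → ℤ → List ℤ
basic n k p q = basicN k p q ++ map +_ (range (suc (bigN k p q)) n)

record BasicTriple (k p : ℕ) (q : ℤ) : Set where
  field
    k>0    : 0 ℕ.< k
    k>1-p-q : ℤ.+ 1 ℤ.- ℤ.+ p ℤ.- q ℤ.< + k
    p>0    : 0 ℕ.< p
    q≢0    : ¬ (q ≡ + 0)
    p≡1⇒q>0 : p ≡ 1 → + 0 ℤ.< q

module Submission where

-- Bruhat order is generated by steps w' → w = w' t, t a
-- reflection, raising the Coxeter length, so we first make the length
-- explicit: the type B inversion number inv (negative entries, plus pairs
-- i < j with w(j) < w(i) or w(j) < -w(i)) is the Coxeter length of every
-- signed permutation (hasLength).  The reflections act as transpositions,
-- signed transpositions and sign changes; each is the conjugate of a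
-- generator by an explicit word, and lowers inv when applied to an
-- inversion of its kind (lowerTr, lowerSw, lowerSg).
--
-- The heart is a reduction lemma: every w of rank r_w(p,q) ≥ k other than
-- w(k,p,q) is the top of a Bruhat step w' → w with w' again of rank ≥ k.
-- Writing w = A ++ B with |A| = p - 1, we sort A and B, split B = X ++ Y at
-- -q and show that X is the block of w(k,p,q) unless a surplus entry or a
-- gap in X yields a move (PositiveQ, NegativeQ).  Iterating the reduction,
-- by induction on inv, from any w of rank ≥ k reaches w(k,p,q) through a
-- chain of Bruhat steps; starting it at the longest element -1 -2 ... -n
-- also shows that w(k,p,q) is a signed permutation of rank ≥ k.

open import Defs

module Minimality where
  open import Data.Nat as ℕ using (ℕ; zero; suc; _+_; _∸_; _≤_; _<_; z≤n; s≤s)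
  import Data.Nat.Properties as ℕP
  open import Data.Nat.Tactic.RingSolver using (solve-∀)
  open import Data.Nat.ListAction using (sum)
  open import Data.Nat.ListAction.Properties using (sum-++; sum-↭)
  open import Data.Integer as ℤ using (ℤ; +_; -[1+_]; -_; ∣_∣; 0ℤ)
  import Data.Integer.Properties as ℤP
  open import Agda.Builtin.Int using (pos)
  open import Data.Fin using (Fin; fromℕ<; toℕ) renaming (zero to fzero; suc to fsuc)
  import Data.Fin.Properties as FinP
  open import Data.List using (List; []; _∷_; _++_; [_]; _∷ʳ_; map; length; reverse; filter; take; drop; applyUpTo)
  import Data.List.Properties as LP
  open import Data.List.Relation.Unary.All as All using (All; []; _∷_)
  import Data.List.Relation.Unary.All.Properties as AllP
  open import Data.List.Relation.Unary.AllPairs as AP using (AllPairs; []; _∷_)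
  import Data.List.Relation.Unary.AllPairs.Properties as APP
  open import Data.List.Relation.Unary.Any as Any using (here; there)
  open import Data.List.Relation.Unary.Linked using (Linked; []; [-]; _∷_)
  import Data.List.Relation.Unary.Linked as Lk
  import Data.List.Relation.Unary.Linked.Properties as LkP
  import Data.List.Relation.Unary.Sorted.TotalOrder.Properties as SortP
  import Data.List.Relation.Binary.Pointwise as PW
  open import Data.List.Relation.Binary.Permutation.Propositional using (_↭_; ↭⇒↭ₛ)
  import Data.List.Relation.Binary.Permutation.Propositional as Pm
  import Data.List.Relation.Binary.Permutation.Propositional.Properties as PermP
  open import Data.List.Membership.Propositional using (_∈_; _∉_; find)
  import Data.List.Membership.Propositional.Properties as MP
  open import Data.List.Membership.DecPropositional ℕ._≟_ using (_∈?_)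
  open import Data.Product using (_×_; _,_; ∃; ∃₂; proj₁; proj₂)
  open import Data.Sum using (_⊎_; inj₁; inj₂)
  open import Data.Empty using (⊥; ⊥-elim)
  open import Relation.Nullary using (Dec; yes; no; ¬_; ¬?)
  open import Relation.Nullary.Decidable using (_×-dec_)
  open import Relation.Binary.PropositionalEquality hiding ([_])
  open import Relation.Binary.Construct.Closure.ReflexiveTransitive using (ε; _◅_; _◅◅_)

  flip< : ∀ {x y} → x ℤ.< - y → y ℤ.< - x
  flip< {x} {y} p = subst (ℤ._< - x) (ℤP.neg-involutive y) (ℤP.neg-mono-< p)

  pos-form : ∀ {v} → 0ℤ ℤ.< v → v ≡ + ∣ v ∣
  pos-form {+ _} _ = refl

  neg-form : ∀ {v} → v ℤ.< 0ℤ → v ≡ - (+ ∣ v ∣)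
  neg-form { -[1+ n ]} _ = refl
  neg-form {+ _} (ℤ.+<+ ())

  nonzero-pos : ∀ {v} → 0ℤ ℤ.≤ v → 1 ≤ ∣ v ∣ → 0ℤ ℤ.< v
  nonzero-pos {+ zero} h ()
  nonzero-pos {+ suc n} h _ = ℤ.+<+ (s≤s z≤n)

  neg-abs≥1 : ∀ {g} → g ℤ.< 0ℤ → 1 ≤ ∣ g ∣
  neg-abs≥1 { -[1+ _ ]} _ = s≤s z≤n
  neg-abs≥1 {+ _} (ℤ.+<+ ())

  abs-lt-neg : ∀ {x g} → x ℤ.< g → g ℤ.< 0ℤ → ∣ g ∣ < ∣ x ∣
  abs-lt-neg { -[1+ a ]} { -[1+ b ]} (ℤ.-<- p) _ = s≤s p
  abs-lt-neg {+ _} { -[1+ b ]} () _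
  abs-lt-neg {_} {+ _} _ (ℤ.+<+ ())

  negbound : ∀ s z → - (+ s) ℤ.< z → z ℤ.< 0ℤ → ∣ z ∣ < s
  negbound s z h1 h2 = subst (∣ z ∣ <_) (ℤP.∣-i∣≡∣i∣ (+ s)) (abs-lt-neg h1 h2)

  absGE : ∀ {v} s → v ℤ.≤ - (+ s) → s ≤ ∣ v ∣
  absGE {v} zero h = z≤n
  absGE { -[1+ j ]} (suc s) (ℤ.-≤- p) = s≤s p

  absPos≤ : ∀ {v} M → 0ℤ ℤ.< v → v ℤ.≤ + M → ∣ v ∣ ≤ M
  absPos≤ M (ℤ.+<+ _) (ℤ.+≤+ p) = p

  absPos> : ∀ {v} M → + M ℤ.< v → M < ∣ v ∣
  absPos> M (ℤ.+<+ p) = p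

  gt-1 : ∀ {v} → -[1+ 0 ] ℤ.< v → 0ℤ ℤ.≤ v
  gt-1 {+ _} _ = ℤ.+≤+ z≤n
  gt-1 { -[1+ _ ]} (ℤ.-<- ())

  neg≤pos : ∀ a b → - (+ a) ℤ.≤ + b
  neg≤pos zero b = ℤ.+≤+ z≤n
  neg≤pos (suc a) b = ℤ.-≤+

  pred< : ∀ i → ℤ.pred i ℤ.< i
  pred< i = ℤP.i≤pred[j]⇒i<j ℤP.≤-refl

  snoc : ∀ {A : Set} (xs : List A) {i} → length xs ≡ suc i → ∃₂ λ ys y → xs ≡ ys ++ [ y ] × length ys ≡ i
  snoc (x ∷ []) {zero} refl = [] , x , refl , refl
  snoc (x ∷ []) {suc i} ()
  snoc (x ∷ x' ∷ xs) {zero} ()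
  snoc (x ∷ x' ∷ xs) {suc i} e with snoc (x' ∷ xs) {i} (ℕP.suc-injective e)
  ... | ys , y , eq , l = x ∷ ys , y , cong (x ∷_) eq , cong suc l

  lastView : ∀ (A : List ℤ) → A ≡ [] ⊎ ∃₂ λ A' a → A ≡ A' ++ [ a ]
  lastView [] = inj₁ refl
  lastView (x ∷ A) with lastView A
  ... | inj₁ refl = inj₂ ([] , x , refl)
  ... | inj₂ (A' , a , e) = inj₂ (x ∷ A' , a , cong (x ∷_) e)

  swapAt-mid : ∀ pre (x y : ℤ) post → swapAt (length pre) (pre ++ x ∷ y ∷ post) ≡ pre ++ y ∷ x ∷ post
  swapAt-mid [] x y post = refl
  swapAt-mid (z ∷ pre) x y post = cong (z ∷_) (swapAt-mid pre x y post)

  take-len : ∀ (A Y : List ℤ) → take (length A) (A ++ Y) ≡ A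
  take-len [] Y = refl
  take-len (x ∷ A) Y = cong (x ∷_) (take-len A Y)

  take-++ : ∀ n (xs ys : List ℤ) → n ≤ length xs → take n (xs ++ ys) ≡ take n xs
  take-++ zero xs ys h = refl
  take-++ (suc n) (x ∷ xs) ys (s≤s h) = cong (x ∷_) (take-++ n xs ys h)

  drop-++ : ∀ n (xs ys : List ℤ) → n ≤ length xs → drop n (xs ++ ys) ≡ drop n xs ++ ys
  drop-++ zero xs ys h = refl
  drop-++ (suc n) (x ∷ xs) ys (s≤s h) = drop-++ n xs ys h

  drop-len : ∀ (A B : List ℤ) → drop (length A) (A ++ B) ≡ B
  drop-len [] B = refl
  drop-len (x ∷ A) B = drop-len A B

  ∈-tail : ∀ {x v : ℤ} {xs} → v ∈ x ∷ xs → v ≢ x → v ∈ xs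
  ∈-tail (here e) ne = ⊥-elim (ne e)
  ∈-tail (there p) ne = p

  ∈-++-mid : ∀ {v : ℤ} A X Y → v ∈ A ++ Y → v ∈ A ++ X ++ Y
  ∈-++-mid {v} A X Y p with MP.∈-++⁻ A p
  ... | inj₁ q = MP.∈-++⁺ˡ q
  ... | inj₂ q = MP.∈-++⁺ʳ A (MP.∈-++⁺ʳ X q)

  inX : ∀ {v : ℤ} A X Y → v ∈ X → v ∈ A ++ X ++ Y
  inX A X Y p = MP.∈-++⁺ʳ A (MP.∈-++⁺ˡ p)

  inY : ∀ {v : ℤ} A X Y → v ∈ Y → v ∈ A ++ X ++ Y
  inY A X Y p = MP.∈-++⁺ʳ A (MP.∈-++⁺ʳ X p)

  loc3 : ∀ {v : ℤ} A X Y → v ∈ A ++ X ++ Y → v ∈ A ⊎ v ∈ X ⊎ v ∈ Y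
  loc3 A X Y p with MP.∈-++⁻ A p
  ... | inj₁ a = inj₁ a
  ... | inj₂ q with MP.∈-++⁻ X q
  ...   | inj₁ x = inj₂ (inj₁ x)
  ...   | inj₂ y = inj₂ (inj₂ y)

  All-mid : ∀ {P : ℤ → Set} X1 x X2 v → All P (X1 ++ [ x ] ++ X2) → P v → All P (X1 ++ v ∷ X2)
  All-mid X1 x X2 v a pv with AllP.++⁻ X1 a
  ... | a1 , (_ ∷ a2) = AllP.++⁺ a1 (pv ∷ a2)

  sum-map-++ : ∀ (f : ℤ → ℕ) xs ys → sum (map f (xs ++ ys)) ≡ sum (map f xs) + sum (map f ys)
  sum-map-++ f xs ys rewrite LP.map-++ f xs ys = sum-++ (map f xs) (map f ys)

  sum2-mono : ∀ (f g f' g' : ℤ → ℕ) xs → (∀ z → f' z + g' z ≤ f z + g z) →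
    sum (map f' xs) + sum (map g' xs) ≤ sum (map f xs) + sum (map g xs)
  sum2-mono f g f' g' [] h = z≤n
  sum2-mono f g f' g' (x ∷ xs) h =
    subst₂ _≤_ (sh (f' x) (g' x) (sum (map f' xs)) (sum (map g' xs)))
               (sh (f x) (g x) (sum (map f xs)) (sum (map g xs)))
               (ℕP.+-mono-≤ (h x) (sum2-mono f g f' g' xs h))
    where
    sh : ∀ a b u v → (a + b) + (u + v) ≡ (a + u) + (b + v)
    sh = solve-∀

  sum-mono : ∀ (f f' : ℤ → ℕ) xs → (∀ z → f' z ≤ f z) → sum (map f' xs) ≤ sum (map f xs)
  sum-mono f f' [] h = z≤n
  sum-mono f f' (x ∷ xs) h = ℕP.+-mono-≤ (h x) (sum-mono f f' xs h)

  comb4 : ∀ {p' q' m' r' p q m r} → p' ≤ p → q' < q → m' ≤ m → r' ≡ r → p' + q' + m' + r' < p + q + m + r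
  comb4 {r' = r'} hp hq hm refl = ℕP.+-monoˡ-< r' (ℕP.+-mono-<-≤ (ℕP.+-mono-≤-< hp hq) hm)

  upFrom : ℕ → ℕ → List ℕ
  upFrom a zero = []
  upFrom a (suc k) = a ∷ upFrom (suc a) k

  applyUpTo-ext : ∀ {A : Set} (f g : ℕ → A) k → (∀ i → f i ≡ g i) → applyUpTo f k ≡ applyUpTo g k
  applyUpTo-ext f g zero h = refl
  applyUpTo-ext f g (suc k) h = cong₂ _∷_ (h 0) (applyUpTo-ext _ _ k (λ i → h (suc i)))

  upFrom-eq : ∀ a k → applyUpTo (λ i → a + i) k ≡ upFrom a k
  upFrom-eq a zero = refl
  upFrom-eq a (suc k) = cong₂ _∷_ (ℕP.+-identityʳ a)
    (trans (applyUpTo-ext _ _ k (λ i → ℕP.+-suc a i)) (upFrom-eq (suc a) k))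

  range-eq : ∀ a b → range a b ≡ upFrom a (suc b ∸ a)
  range-eq a b = upFrom-eq a (suc b ∸ a)

  identity-eq : ∀ n → identity n ≡ map pos (upFrom 1 n)
  identity-eq n = cong (map pos) (upFrom-eq 1 n)

  upFrom-sorted : ∀ a k → Linked _≤_ (upFrom a k)
  upFrom-sorted a zero = []
  upFrom-sorted a (suc zero) = [-]
  upFrom-sorted a (suc (suc k)) = ℕP.n≤1+n a ∷ upFrom-sorted (suc a) (suc k)

  ∈-upFrom⁻ : ∀ {u} a k → u ∈ upFrom a k → a ≤ u × u < a + k
  ∈-upFrom⁻ a (suc k) (here refl) = ℕP.≤-refl , ℕP.m<m+n a (s≤s z≤n)
  ∈-upFrom⁻ a (suc k) (there p) with ∈-upFrom⁻ (suc a) k p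
  ... | h1 , h2 = ℕP.<⇒≤ h1 , ℕP.≤-trans h2 (ℕP.≤-reflexive (sym (ℕP.+-suc a k)))

  ∈-upFrom⁺ : ∀ {u} a k → a ≤ u → u < a + k → u ∈ upFrom a k
  ∈-upFrom⁺ {u} a zero h1 h2 = ⊥-elim (ℕP.<-irrefl refl (ℕP.<-≤-trans h2 (ℕP.≤-trans (ℕP.≤-reflexive (ℕP.+-identityʳ a)) h1)))
  ∈-upFrom⁺ {u} a (suc k) h1 h2 with a ℕP.≟ u
  ... | yes refl = here refl
  ... | no ne = there (∈-upFrom⁺ (suc a) k (ℕP.≤∧≢⇒< h1 ne) (ℕP.≤-trans h2 (ℕP.≤-reflexive (ℕP.+-suc a k))))

  upFrom-AP : ∀ a k → AllPairs _<_ (upFrom a k)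
  upFrom-AP a zero = []
  upFrom-AP a (suc k) = All.tabulate (λ {u} p → proj₁ (∈-upFrom⁻ (suc a) k p)) ∷ upFrom-AP (suc a) k

  length-upFrom : ∀ a L → length (upFrom a L) ≡ L
  length-upFrom a zero = refl
  length-upFrom a (suc L) = cong suc (length-upFrom (suc a) L)

  drop-upFrom : ∀ j a L → drop j (upFrom a L) ≡ upFrom (a + j) (L ∸ j)
  drop-upFrom zero a L = cong (λ z → upFrom z L) (sym (ℕP.+-identityʳ a))
  drop-upFrom (suc j) a zero = refl
  drop-upFrom (suc j) a (suc L) = trans (drop-upFrom j (suc a) L) (cong (λ z → upFrom z (L ∸ j)) (sym (ℕP.+-suc a j)))

  upFrom-++ : ∀ a x y → upFrom a (x + y) ≡ upFrom a x ++ upFrom (a + x) y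
  upFrom-++ a zero y = cong (λ z → upFrom z y) (sym (ℕP.+-identityʳ a))
  upFrom-++ a (suc x) y = cong (a ∷_) (trans (upFrom-++ (suc a) x y) (cong (λ z → upFrom (suc a) x ++ upFrom z y) (sym (ℕP.+-suc a x))))

  upFrom-snoc : ∀ a L → upFrom a (suc L) ≡ upFrom a L ++ [ a + L ]
  upFrom-snoc a zero = cong (λ z → z ∷ []) (sym (ℕP.+-identityʳ a))
  upFrom-snoc a (suc L) = cong (a ∷_) (trans (upFrom-snoc (suc a) L) (cong (λ z → upFrom (suc a) L ++ [ z ]) (sym (ℕP.+-suc a L))))

  Dis : List ℤ → Set
  Dis = AllPairs (λ x y → ∣ x ∣ ≢ ∣ y ∣)

  AP-↭ : ∀ {R : ℕ → ℕ → Set} → (∀ {x y} → R x y → R y x) → ∀ {xs ys} → xs ↭ ys → AllPairs R xs → AllPairs R ys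
  AP-↭ s Pm.refl p = p
  AP-↭ s (Pm.prep x q) (a ∷ p) = PermP.All-resp-↭ q a ∷ AP-↭ s q p
  AP-↭ s (Pm.swap x y q) ((rxy ∷ ax) ∷ (ay ∷ p)) = (s rxy ∷ PermP.All-resp-↭ q ay) ∷ (PermP.All-resp-↭ q ax ∷ AP-↭ s q p)
  AP-↭ s (Pm.trans q q') p = AP-↭ s q' (AP-↭ s q p)

  AP-++⁻ : ∀ {A : Set} {R : A → A → Set} xs ys → AllPairs R (xs ++ ys) → AllPairs R xs × AllPairs R ys × All (λ x → All (R x) ys) xs
  AP-++⁻ [] ys p = [] , p , []
  AP-++⁻ (x ∷ xs) ys (a ∷ p) with AP-++⁻ xs ys p
  ... | p1 , p2 , p3 = (AllP.++⁻ˡ xs a ∷ p1) , p2 , (AllP.++⁻ʳ xs a ∷ p3)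

  lk-all< : ∀ {x xs} → Linked ℤ._<_ (x ∷ xs) → All (x ℤ.<_) xs
  lk-all< [-] = []
  lk-all< (h ∷ l) = h ∷ All.map (ℤP.<-trans h) (lk-all< l)

  lk-all≤ : ∀ {x xs} → Linked ℤ._≤_ (x ∷ xs) → All (x ℤ.≤_) xs
  lk-all≤ [-] = []
  lk-all≤ (h ∷ l) = h ∷ All.map (ℤP.≤-trans h) (lk-all≤ l)

  lk-++ˡ : ∀ {R : ℤ → ℤ → Set} xs {ys} → Linked R (xs ++ ys) → Linked R xs
  lk-++ˡ [] l = []
  lk-++ˡ (x ∷ []) l = [-]
  lk-++ˡ (x ∷ y ∷ xs) (h ∷ l) = h ∷ lk-++ˡ (y ∷ xs) l

  lk-++ʳ : ∀ {R : ℤ → ℤ → Set} xs {ys} → Linked R (xs ++ ys) → Linked R ys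
  lk-++ʳ [] l = l
  lk-++ʳ (x ∷ xs) l = lk-++ʳ xs (Lk.tail l)

  lk-join : ∀ A' a Y → Linked ℤ._<_ (A' ++ [ a ]) → Linked ℤ._<_ Y → All (a ℤ.<_) Y → Linked ℤ._<_ ((A' ++ [ a ]) ++ Y)
  lk-join [] a [] l ly ay = [-]
  lk-join [] a (y ∷ Y) l ly (h ∷ _) = h ∷ ly
  lk-join (x ∷ []) a Y (h ∷ l) ly ay = h ∷ lk-join [] a Y l ly ay
  lk-join (x ∷ x' ∷ A') a Y (h ∷ l) ly ay = h ∷ lk-join (x' ∷ A') a Y l ly ay

  lk-nonneg : ∀ {x xs} → 0ℤ ℤ.≤ x → Linked ℤ._≤_ (x ∷ xs) → All (0ℤ ℤ.≤_) (x ∷ xs)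
  lk-nonneg {x} {[]} h l = h ∷ []
  lk-nonneg {x} {y ∷ ys} h (xy ∷ l) = h ∷ lk-nonneg (ℤP.≤-trans h xy) l

  lk≤ : ∀ {xs} → Linked ℤ._<_ xs → Linked ℤ._≤_ xs
  lk≤ = Lk.map ℤP.<⇒≤

  strictify : ∀ xs → Linked ℤ._≤_ xs → Dis xs → Linked ℤ._<_ xs
  strictify [] l d = []
  strictify (x ∷ []) l d = [-]
  strictify (x ∷ y ∷ xs) (h ∷ l) ((ne ∷ _) ∷ d) = ℤP.≤∧≢⇒< h (λ e → ne (cong ∣_∣ e)) ∷ strictify (y ∷ xs) l d

  sorted-unique : ∀ xs ys → Linked ℤ._<_ xs → Linked ℤ._<_ ys →
    (∀ {v} → v ∈ xs → v ∈ ys) → (∀ {v} → v ∈ ys → v ∈ xs) → xs ≡ ys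
  sorted-unique [] [] lx ly f g = refl
  sorted-unique [] (y ∷ ys) lx ly f g with g {y} (here refl)
  ... | ()
  sorted-unique (x ∷ xs) [] lx ly f g with f {x} (here refl)
  ... | ()
  sorted-unique (x ∷ xs) (y ∷ ys) lx ly f g = cong₂ _∷_ xy
     (sorted-unique xs ys (Lk.tail lx) (Lk.tail ly)
       (λ {v} p → ∈-tail (f (there p)) (λ e → ℤP.<-irrefl (sym (trans e (sym xy))) (All.lookup (lk-all< lx) p)))
       (λ {v} p → ∈-tail (g (there p)) (λ e → ℤP.<-irrefl (sym (trans e xy)) (All.lookup (lk-all< ly) p))))
    where
    xy : x ≡ y
    hx : x ∈ x ∷ xs
    hx = here refl
    hy : y ∈ y ∷ ys
    hy = here refl
    xy with f hx | g hy
    ... | here e | _ = e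
    ... | there _ | here e = sym e
    ... | there p | there p' = ⊥-elim (ℤP.<-asym (All.lookup (lk-all< ly) p) (All.lookup (lk-all< lx) p'))

  split : ∀ (t : ℤ) B → Linked ℤ._≤_ B → ∃₂ λ X Y → B ≡ X ++ Y × All (ℤ._≤ t) X × All (t ℤ.<_) Y
  split t [] l = [] , [] , refl , [] , []
  split t (x ∷ B) l with x ℤ.≤? t
  ... | yes p with split t B (Lk.tail l)
  ...   | X , Y , e , ax , ay = x ∷ X , Y , cong (x ∷_) e , p ∷ ax , ay
  split t (x ∷ B) l | no p = [] , x ∷ B , refl , [] , (ℤP.≰⇒> p ∷ All.map (λ h → ℤP.<-≤-trans (ℤP.≰⇒> p) h) (lk-all≤ l))

  head0 : List ℤ → ℤ
  head0 [] = 0ℤ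
  head0 (x ∷ _) = x

  pos-of : ∀ {xs : List ℤ} → 0ℤ ℤ.≤ head0 xs → Linked ℤ._<_ xs → (∀ {v} → v ∈ xs → 1 ≤ ∣ v ∣) → All (0ℤ ℤ.<_) xs
  pos-of {[]} h l f = []
  pos-of {x ∷ xs} h l f = All.tabulate λ {v} mv → nonzero-pos (All.lookup (lk-nonneg h (lk≤ l)) mv) (f mv)

  last-max : ∀ A' a → Linked ℤ._<_ (A' ++ [ a ]) → All (ℤ._≤ a) (A' ++ [ a ])
  last-max [] a l = ℤP.≤-refl ∷ []
  last-max (x ∷ A') a l = ℤP.<⇒≤ (All.lookup (lk-all< l) (MP.∈-++⁺ʳ A' (here refl))) ∷ last-max A' a (Lk.tail l)

  count-bound : ∀ lo hi xs → Linked ℤ._<_ xs → All (λ v → + lo ℤ.< v × v ℤ.≤ + hi) xs → length xs ≤ hi ∸ lo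
  count-bound lo hi [] l a = z≤n
  count-bound lo hi (.(+ x') ∷ xs) l ((ℤ.+<+ {n = x'} p , ℤ.+≤+ q) ∷ a) =
    ℕP.≤-trans (s≤s (count-bound x' hi xs (Lk.tail l) (All.zipWith (λ (h1 , (_ , h2)) → h1 , h2) (lk-all< l , a))))
               (ℕP.∸-monoʳ-< p q)

  Adj : List ℤ → Set
  Adj w = ∃₂ λ pre a → ∃₂ λ b post → w ≡ pre ++ a ∷ b ∷ post × b ℤ.< a

  adj2 : ∀ x y ys → Linked ℤ._≤_ (y ∷ ys) ⊎ Adj (y ∷ ys) → Linked ℤ._≤_ (x ∷ y ∷ ys) ⊎ Adj (x ∷ y ∷ ys)
  adj2 x y ys r with y ℤ.<? x
  ... | yes p = inj₂ ([] , x , y , ys , refl , p)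
  ... | no p with r
  ...   | inj₁ l = inj₁ (ℤP.≮⇒≥ p ∷ l)
  ...   | inj₂ (pre , a , b , post , e , q) = inj₂ (x ∷ pre , a , b , post , cong (x ∷_) e , q)

  adj : ∀ w → Linked ℤ._≤_ w ⊎ Adj w
  adj [] = inj₁ []
  adj (x ∷ []) = inj₁ [-]
  adj (x ∷ y ∷ ys) = adj2 x y ys (adj (y ∷ ys))

  -- low top L = top - L, and runU top L = [top-L+1, ..., top]
  low : ℤ → ℕ → ℤ
  low top zero = top
  low top (suc L) = ℤ.pred (low top L)

  runU : ℤ → ℕ → List ℤ
  runU top zero = []
  runU top (suc L) = low top L ∷ runU top L

  low≤ : ∀ top L → low top L ℤ.≤ top
  low≤ top zero = ℤP.≤-refl
  low≤ top (suc L) = ℤP.≤-trans (ℤP.<⇒≤ (pred< _)) (low≤ top L)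

  run-elem : ∀ top L {v} → v ∈ runU top L → low top L ℤ.< v × v ℤ.≤ top
  run-elem top (suc L) (here refl) = pred< _ , low≤ top L
  run-elem top (suc L) (there p) with run-elem top L p
  ... | h1 , h2 = ℤP.<-trans (pred< _) h1 , h2

  Gap : ℤ → List ℤ → Set
  Gap top X = ∃₂ λ g x → x ∈ X × x ℤ.< g × g ℤ.≤ top × g ∉ X

  xle-lem : ∀ top x X → Linked ℤ._<_ (x ∷ X) → x ℤ.≤ top → X ≡ runU top (length X) → x ℤ.≤ low top (length X)
  xle-lem top x [] l ax e = ax
  xle-lem top x (y ∷ Y) l ax e = subst (λ z → x ℤ.≤ ℤ.pred z) (LP.∷-injectiveˡ e) (ℤP.i<j⇒i≤pred[j] {x} {y} (All.lookup (lk-all< l) (here refl)))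

  gap : ∀ top X → Linked ℤ._<_ X → All (ℤ._≤ top) X → X ≡ runU top (length X) ⊎ Gap top X
  gap top [] l a = inj₁ refl
  gap top (x ∷ X) l (ax ∷ a) with gap top X (Lk.tail l) a
  ... | inj₂ (g , x' , mem , lt , le , nm) =
    inj₂ (g , x' , there mem , lt , le , λ { (here e) → ℤP.<-irrefl (sym e) (ℤP.<-trans (All.lookup (lk-all< l) mem) lt) ; (there p) → nm p })
  ... | inj₁ e with x ℤP.≟ low top (length X)
  ...   | yes ex = inj₁ (cong₂ _∷_ ex e)
  ...   | no nx = inj₂ (low top (length X) , x , here refl , ℤP.≤∧≢⇒< (xle-lem top x X l ax e) nx , low≤ top (length X) ,
                    λ { (here ex) → nx (sym ex) ; (there p) → ℤP.<-irrefl refl (proj₁ (run-elem top (length X) (subst (low top (length X) ∈_) e p))) })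

  low-neg : ∀ c L → low (- (+ c)) L ≡ - (+ (c + L))
  low-neg c zero = cong (λ z → - (+ z)) (sym (ℕP.+-identityʳ c))
  low-neg c (suc L) rewrite low-neg c L | ℕP.+-suc c L = sym (ℤP.neg-suc (c + L))

  low-pos : ∀ a L → low (+ (a + L)) L ≡ + a
  low-pos a zero = cong +_ (ℕP.+-identityʳ a)
  low-pos a (suc L) rewrite ℕP.+-suc a L | low-pos (suc a) L = refl

  lowP : ∀ M L → L ≤ M → low (+ M) L ≡ + (M ∸ L)
  lowP M L h = trans (cong (λ z → low (+ z) L) (sym (ℕP.m∸n+n≡m h))) (low-pos (M ∸ L) L)

  -- a run of length ≥ M ending at M reaches 0, so a positive run ending at M
  -- has length < M
  lowNonPos : ∀ M d → low (+ M) (M + d) ℤ.≤ 0ℤ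
  lowNonPos M zero = subst (ℤ._≤ 0ℤ) (sym (trans (cong (low (+ M)) (ℕP.+-identityʳ M)) (trans (lowP M M ℕP.≤-refl) (cong +_ (ℕP.n∸n≡0 M))))) ℤP.≤-refl
  lowNonPos M (suc d) = subst (ℤ._≤ 0ℤ) (cong (low (+ M)) (sym (ℕP.+-suc M d))) (ℤP.≤-trans (ℤP.<⇒≤ (pred< _)) (lowNonPos M d))

  lowPos⇒lt : ∀ M L → 0ℤ ℤ.< low (+ M) L → L < M
  lowPos⇒lt M L h with L ℕ.<? M
  ... | yes lt = lt
  ... | no nlt = ⊥-elim (ℤP.<-irrefl refl (ℤP.<-≤-trans h (subst (λ z → low (+ M) z ℤ.≤ 0ℤ) (ℕP.m+[n∸m]≡n (ℕP.≮⇒≥ nlt)) (lowNonPos M (L ∸ M)))))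

  runLen≤ : ∀ M Xp → Xp ≡ runU (+ M) (length Xp) → All (0ℤ ℤ.<_) Xp → length Xp ≤ M
  runLen≤ M [] e a = z≤n
  runLen≤ M (h ∷ Xp') e (hp ∷ _) = lowPos⇒lt M (length Xp') (subst (0ℤ ℤ.<_) (LP.∷-injectiveˡ e) hp)

  AU : ∀ top L (g : ℕ → ℤ) → (∀ j → j < L → g j ≡ low top (L ∸ 1 ∸ j)) → applyUpTo g L ≡ runU top L
  AU top zero g h = refl
  AU top (suc L) g h = cong₂ _∷_ (h 0 (s≤s z≤n))
    (AU top L (λ j → g (suc j)) (λ j jl → trans (h (suc j) (s≤s jl)) (cong (low top) (sym (ℕP.∸-+-assoc L 1 j)))))

  SP-↭ : ∀ {n w w'} → w' ↭ w → IsSignedPerm n w → IsSignedPerm n w'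
  SP-↭ p (l , q) = trans (PermP.↭-length p) l , Pm.↭-trans (PermP.map⁺ ∣_∣ p) q

  SP-abs : ∀ {n w w'} → map ∣_∣ w' ≡ map ∣_∣ w → length w' ≡ length w → IsSignedPerm n w → IsSignedPerm n w'
  SP-abs e l (l' , q) = trans l l' , subst (_↭ _) (sym e) q

  abs-neg1 : ∀ pre x post → map ∣_∣ (pre ++ (- x) ∷ post) ≡ map ∣_∣ (pre ++ x ∷ post)
  abs-neg1 pre x post rewrite LP.map-++ ∣_∣ pre ((- x) ∷ post) | LP.map-++ ∣_∣ pre (x ∷ post) | ℤP.∣-i∣≡∣i∣ x = refl

  length-replace : ∀ pre (x y : ℤ) post → length (pre ++ x ∷ post) ≡ length (pre ++ y ∷ post)
  length-replace pre x y post rewrite LP.length-++ pre {x ∷ post} | LP.length-++ pre {y ∷ post} = refl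

  abs2 : ∀ pre (a : ℤ) mid b post → map ∣_∣ (pre ++ (- b) ∷ mid ++ (- a) ∷ post) ≡ map ∣_∣ (pre ++ b ∷ mid ++ a ∷ post)
  abs2 pre a mid b post rewrite LP.map-++ ∣_∣ pre ((- b) ∷ mid ++ (- a) ∷ post) | LP.map-++ ∣_∣ pre (b ∷ mid ++ a ∷ post)
    | LP.map-++ ∣_∣ mid ((- a) ∷ post) | LP.map-++ ∣_∣ mid (a ∷ post) | ℤP.∣-i∣≡∣i∣ a | ℤP.∣-i∣≡∣i∣ b = refl

  tr-perm : ∀ pre (a : ℤ) mid b post → pre ++ b ∷ mid ++ a ∷ post ↭ pre ++ a ∷ mid ++ b ∷ post
  tr-perm pre a mid b post = PermP.++⁺ˡ pre
    (Pm.↭-trans (Pm.prep b (PermP.shift a mid post))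
      (Pm.↭-trans (Pm.swap b a Pm.refl) (Pm.prep a (Pm.↭-sym (PermP.shift b mid post)))))

  SP-dis : ∀ {n w} → IsSignedPerm n w → Dis w
  SP-dis {n} {w} (_ , p) = APP.map⁻ (AP-↭ (λ ne e → ne (sym e)) (Pm.↭-sym p)
    (subst (AllPairs _≢_) (sym (range-eq 1 n)) (AP.map (λ {x} {y} lt e → ℕP.<⇒≢ lt e) (upFrom-AP 1 n))))

  SP-range : ∀ {n w v} → IsSignedPerm n w → v ∈ w → 1 ≤ ∣ v ∣ × ∣ v ∣ ≤ n
  SP-range {n} {w} {v} (_ , p) mem with ∈-upFrom⁻ 1 n (subst (∣ v ∣ ∈_) (range-eq 1 n) (PermP.∈-resp-↭ p (MP.∈-map⁺ ∣_∣ mem)))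
  ... | h1 , h2 = h1 , ℕP.≤-pred h2

  SP-find : ∀ {n w u} → IsSignedPerm n w → 1 ≤ u → u ≤ n → ∃ λ e → e ∈ w × ∣ e ∣ ≡ u
  SP-find {n} {w} {u} (_ , p) h1 h2 with MP.∈-map⁻ ∣_∣ (PermP.∈-resp-↭ (Pm.↭-sym p) (subst (u ∈_) (sym (range-eq 1 n)) (∈-upFrom⁺ 1 n h1 (s≤s h2))))
  ... | e , mem , eq = e , mem , sym eq

  disj : ∀ A X Y → Dis (A ++ X ++ Y) → ∀ {v z} → v ∈ A ++ Y → z ∈ X → ∣ v ∣ ≢ ∣ z ∣
  disj A X Y d {v} {z} mv mz with AP-++⁻ A (X ++ Y) d
  ... | _ , dXY , cross with MP.∈-++⁻ A mv
  ...   | inj₁ va = All.lookup (All.lookup cross va) (MP.∈-++⁺ˡ mz)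
  ...   | inj₂ vy with AP-++⁻ X Y dXY
  ...     | _ , _ , cross2 = λ e → All.lookup (All.lookup cross2 mz) vy (sym e)

  disAY : ∀ A X Y → Dis (A ++ X ++ Y) → ∀ {a y} → a ∈ A → y ∈ Y → a ≢ y
  disAY A X Y d {a} {y} ma my e with AP-++⁻ A (X ++ Y) d
  ... | _ , _ , cross = All.lookup (All.lookup cross ma) (MP.∈-++⁺ʳ X my) (cong ∣_∣ e)

  disAX : ∀ A X Y → Dis (A ++ X ++ Y) → ∀ {a x} → a ∈ A → x ∈ X → a ≢ x
  disAX A X Y d {a} {x} ma mx e with AP-++⁻ A (X ++ Y) d
  ... | _ , _ , cross = All.lookup (All.lookup cross ma) (MP.∈-++⁺ˡ mx) (cong ∣_∣ e)

  lin-abs : ∀ w → Linked ℤ._≤_ w → All (0ℤ ℤ.≤_) w → Linked _≤_ (map ∣_∣ w)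
  lin-abs [] l a = []
  lin-abs (x ∷ []) l a = [-]
  lin-abs (.(+ _) ∷ .(+ _) ∷ ys) (ℤ.+≤+ p ∷ l) (ℤ.+≤+ _ ∷ a) = p ∷ lin-abs _ l a

  pos-abs : ∀ w → All (0ℤ ℤ.≤_) w → map pos (map ∣_∣ w) ≡ w
  pos-abs [] a = refl
  pos-abs (x ∷ w) (h ∷ a) = cong₂ _∷_ (ℤP.0≤i⇒+∣i∣≡i h) (pos-abs w a)

  ident : ∀ n w → Linked ℤ._≤_ w → All (0ℤ ℤ.≤_) w → map ∣_∣ w ↭ range 1 n → w ≡ identity n
  ident n w l a p =
    trans (sym (pos-abs w a))
     (trans (cong (map pos) (PW.Pointwise-≡⇒≡ (SortP.↗↭↗⇒≋ ℕP.≤-totalOrder (lin-abs w l a) (upFrom-sorted 1 n)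
                   (↭⇒↭ₛ (subst (map ∣_∣ w ↭_) (range-eq 1 n) p)))))
       (sym (identity-eq n)))

  -- For w = w(1)...w(n) in one-line notation,
  --   inv w = #{i : w(i) < 0} + #{i < j : w(j) < w(i)} + #{i < j : w(j) < -w(i)},
  -- which is the Coxeter length of w in B_n.
  ltInd : ℤ → ℤ → ℕ
  ltInd x y with x ℤ.<? y
  ... | yes _ = 1
  ... | no _ = 0

  ltInd-mono : ∀ {x y u v} → (x ℤ.< y → u ℤ.< v) → ltInd x y ≤ ltInd u v
  ltInd-mono {x} {y} {u} {v} f with x ℤ.<? y | u ℤ.<? v
  ... | yes _ | yes _ = s≤s z≤n
  ... | yes p | no q = ⊥-elim (q (f p))
  ... | no _ | _ = z≤n

  ltInd-cong : ∀ {x y u v} → (x ℤ.< y → u ℤ.< v) → (u ℤ.< v → x ℤ.< y) → ltInd x y ≡ ltInd u v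
  ltInd-cong f g = ℕP.≤-antisym (ltInd-mono f) (ltInd-mono g)

  ltInd-1 : ∀ {x y} → x ℤ.< y → ltInd x y ≡ 1
  ltInd-1 {x} {y} p with x ℤ.<? y
  ... | yes _ = refl
  ... | no q = ⊥-elim (q p)

  ltInd-0 : ∀ {x y} → ¬ (x ℤ.< y) → ltInd x y ≡ 0
  ltInd-0 {x} {y} p with x ℤ.<? y
  ... | yes q = ⊥-elim (p q)
  ... | no _ = refl

  ltInd≤1 : ∀ x y → ltInd x y ≤ 1
  ltInd≤1 x y with x ℤ.<? y
  ... | yes _ = s≤s z≤n
  ... | no _ = z≤n

  negInd : ℤ → ℕ
  negInd x = ltInd x 0ℤ

  pairInv : ℤ → ℤ → ℕ
  pairInv x y = ltInd y x + ltInd y (- x)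

  invFrom : ℤ → List ℤ → ℕ
  invFrom x ys = sum (map (pairInv x) ys)

  invInto : List ℤ → ℤ → ℕ
  invInto xs y = sum (map (λ x → pairInv x y) xs)

  invCross : List ℤ → List ℤ → ℕ
  invCross xs ys = sum (map (λ x → invFrom x ys) xs)

  inv : List ℤ → ℕ
  inv [] = 0
  inv (x ∷ xs) = negInd x + invFrom x xs + inv xs

  pairInv-neg : ∀ x y → pairInv (- x) y ≡ pairInv x y
  pairInv-neg x y rewrite ℤP.neg-involutive x = ℕP.+-comm (ltInd y (- x)) (ltInd y x)

  invFrom-neg : ∀ x ys → invFrom (- x) ys ≡ invFrom x ys
  invFrom-neg x [] = refl
  invFrom-neg x (y ∷ ys) = cong₂ _+_ (pairInv-neg x y) (invFrom-neg x ys)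

  invFrom-++ : ∀ x ys zs → invFrom x (ys ++ zs) ≡ invFrom x ys + invFrom x zs
  invFrom-++ x ys zs = sum-map-++ (pairInv x) ys zs

  invCross-++ : ∀ xs ys zs → invCross xs (ys ++ zs) ≡ invCross xs ys + invCross xs zs
  invCross-++ [] ys zs = refl
  invCross-++ (x ∷ xs) ys zs rewrite invFrom-++ x ys zs | invCross-++ xs ys zs = sh (invFrom x ys) (invFrom x zs) (invCross xs ys) (invCross xs zs)
    where
    sh : ∀ a b u v → (a + b) + (u + v) ≡ (a + u) + (b + v)
    sh = solve-∀

  invCross-∷ : ∀ xs y ys → invCross xs (y ∷ ys) ≡ invInto xs y + invCross xs ys
  invCross-∷ [] y ys = refl
  invCross-∷ (x ∷ xs) y ys rewrite invCross-∷ xs y ys = sh (pairInv x y) (invFrom x ys) (invInto xs y) (invCross xs ys)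
    where
    sh : ∀ a b u v → (a + b) + (u + v) ≡ (a + u) + (b + v)
    sh = solve-∀

  inv-++ : ∀ xs ys → inv (xs ++ ys) ≡ inv xs + invCross xs ys + inv ys
  inv-++ [] ys = refl
  inv-++ (x ∷ xs) ys rewrite invFrom-++ x xs ys | inv-++ xs ys =
    sh (negInd x) (invFrom x xs) (invFrom x ys) (inv xs) (invCross xs ys) (inv ys)
    where
    sh : ∀ a b c d e f → a + (b + c) + (d + e + f) ≡ a + b + d + (c + e) + f
    sh = solve-∀

  -- Splitting inv at two marked entries a, b of  pre ++ a ∷ mid ++ b ∷ post:
  -- a part not involving a, b and a part collecting every term that does.
  fixed₂ : List ℤ → List ℤ → List ℤ → ℕ
  fixed₂ pre mid post = inv pre + invCross pre mid + invCross pre post + inv mid + invCross mid post + inv post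

  moving₂ : List ℤ → List ℤ → List ℤ → ℤ → ℤ → ℕ
  moving₂ pre mid post a b = (invInto pre a + invInto pre b) + (negInd a + negInd b + pairInv a b) + (invFrom a mid + invInto mid b) + (invFrom a post + invFrom b post)

  inv-two : ∀ pre a mid b post → inv (pre ++ a ∷ mid ++ b ∷ post) ≡ fixed₂ pre mid post + moving₂ pre mid post a b
  inv-two pre a mid b post
    rewrite inv-++ pre (a ∷ mid ++ b ∷ post) | invCross-∷ pre a (mid ++ b ∷ post) | invCross-++ pre mid (b ∷ post)
          | invCross-∷ pre b post | invFrom-++ a mid (b ∷ post) | inv-++ mid (b ∷ post) | invCross-∷ mid b post =
    sh (inv pre) (invInto pre a) (invCross pre mid) (invInto pre b) (invCross pre post) (negInd a) (invFrom a mid) (pairInv a b) (invFrom a post)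
       (inv mid) (invInto mid b) (invCross mid post) (negInd b) (invFrom b post) (inv post)
    where
    sh : ∀ lp spa xpm spb xpp na sam cab sap lm smb xmp nb sbp lpo →
       lp + (spa + (xpm + (spb + xpp))) + (na + (sam + (cab + sap)) + (lm + (smb + xmp) + (nb + sbp + lpo)))
       ≡ lp + xpm + xpp + lm + xmp + lpo + ((spa + spb) + (na + nb + cab) + (sam + smb) + (sap + sbp))
    sh = solve-∀

  fixed₁ : List ℤ → List ℤ → ℕ
  fixed₁ pre post = inv pre + invCross pre post + inv post

  moving₁ : List ℤ → List ℤ → ℤ → ℕ
  moving₁ pre post a = invInto pre a + negInd a + invFrom a post

  inv-one : ∀ pre a post → inv (pre ++ a ∷ post) ≡ fixed₁ pre post + moving₁ pre post a
  inv-one pre a post rewrite inv-++ pre (a ∷ post) | invCross-∷ pre a post =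
    sh (inv pre) (invInto pre a) (invCross pre post) (negInd a) (invFrom a post) (inv post)
    where
    sh : ∀ lp spa xpp na sap lpo → lp + (spa + xpp) + (na + sap + lpo) ≡ lp + xpp + lpo + (spa + na + sap)
    sh = solve-∀

  -- Comparison of the moving terms, entry by entry, for the three kinds of
  -- reflections.  Signed transposition: a , b ↦ -b , -a when b < -a.
  sw-pre : ∀ {a b} → b ℤ.< - a → ∀ z → pairInv z (- b) + pairInv z (- a) ≤ pairInv z a + pairInv z b
  sw-pre {a} {b} h z = ℕP.+-mono-≤ (ℕP.+-mono-≤ (ltInd-mono (ℤP.<-trans (flip< h))) (ltInd-mono (ℤP.<-trans (flip< h))))
                           (ℕP.+-mono-≤ (ltInd-mono (ℤP.<-trans h)) (ltInd-mono (ℤP.<-trans h)))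

  sw-mid : ∀ {a b} → b ℤ.< - a → ∀ z → pairInv (- b) z + pairInv z (- a) ≤ pairInv a z + pairInv z b
  sw-mid {a} {b} h z = ℕP.≤-trans (ℕP.≤-reflexive (sh (ltInd z (- b)) (ltInd z (- - b)) (ltInd (- a) z) (ltInd (- a) (- z))))
     (ℕP.+-mono-≤ (ℕP.+-mono-≤ (ltInd-mono { - a} { - z} {z} {a} ℤP.neg-cancel-<) (ltInd-mono {z} { - - b} {z} { - a} λ p → ℤP.<-trans (subst (z ℤ.<_) (ℤP.neg-involutive b) p) h))
          (ℕP.+-mono-≤ (ltInd-mono { - a} {z} {b} {z} (ℤP.<-trans h)) (ltInd-mono {z} { - b} {b} { - z} flip<)))
    where
    sh : ∀ x1 x2 x3 x4 → x1 + x2 + (x3 + x4) ≡ x4 + x2 + (x3 + x1)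
    sh = solve-∀

  sw-pair : ∀ {a b} → b ℤ.< - a → negInd (- b) + negInd (- a) + pairInv (- b) (- a) < negInd a + negInd b + pairInv a b
  sw-pair {a} {b} h = ℕP.≤-trans (ℕP.≤-reflexive (sh (negInd (- b)) (negInd (- a)) (ltInd (- a) (- b)) (ltInd (- a) (- - b))))
     (ℕP.+-mono-≤ (ℕP.+-mono-≤ (ltInd-mono λ p → ℤP.<-trans (flip< h) p) (ltInd-mono λ p → ℤP.<-trans h p))
          (ℕP.+-mono-≤ (ltInd-mono ℤP.neg-cancel-<)
            (ℕP.≤-reflexive (trans (cong suc (ltInd-0 λ p → ℤP.<-asym h (subst (- a ℤ.<_) (ℤP.neg-involutive b) p)))
                              (sym (ltInd-1 h))))))
    where
    sh : ∀ x1 x2 x3 x4 → suc (x1 + x2 + (x3 + x4)) ≡ x1 + x2 + (x3 + suc x4)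
    sh = solve-∀

  sw-post : ∀ a b post → invFrom (- b) post + invFrom (- a) post ≡ invFrom a post + invFrom b post
  sw-post a b post rewrite invFrom-neg b post | invFrom-neg a post = ℕP.+-comm (invFrom b post) (invFrom a post)

  -- transposition: a , b ↦ b , a when b < a
  tr-mid : ∀ {a b} → b ℤ.< a → ∀ z → pairInv b z + pairInv z a ≤ pairInv a z + pairInv z b
  tr-mid {a} {b} h z = ℕP.≤-trans (ℕP.≤-reflexive (sh (ltInd z b) (ltInd z (- b)) (ltInd a z) (ltInd a (- z))))
     (ℕP.+-mono-≤ (ℕP.+-mono-≤ (ltInd-mono {z} {b} {z} {a} λ p → ℤP.<-trans p h) (ltInd-mono {a} { - z} {z} { - a} flip<))
          (ℕP.+-mono-≤ (ltInd-mono {a} {z} {b} {z} (ℤP.<-trans h)) (ltInd-mono {z} { - b} {b} { - z} flip<)))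
    where
    sh : ∀ x1 x2 x3 x4 → x1 + x2 + (x3 + x4) ≡ x1 + x4 + (x3 + x2)
    sh = solve-∀

  tr-pair : ∀ {a b} → b ℤ.< a → negInd b + negInd a + pairInv b a < negInd a + negInd b + pairInv a b
  tr-pair {a} {b} h = ℕP.≤-trans (ℕP.≤-reflexive (sh (negInd b) (negInd a) (ltInd a b) (ltInd a (- b))))
     (ℕP.+-mono-≤ (ℕP.≤-reflexive (ℕP.+-comm (negInd b) (negInd a)))
          (ℕP.≤-trans (ℕP.≤-reflexive (cong (λ t → suc (t + ltInd a (- b))) (ltInd-0 (ℤP.<-asym h))))
                (ℕP.≤-trans (s≤s (ltInd-mono flip<)) (ℕP.≤-reflexive (cong (_+ ltInd b (- a)) (sym (ltInd-1 h)))))))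
    where
    sh : ∀ x1 x2 x3 x4 → suc (x1 + x2 + (x3 + x4)) ≡ x1 + x2 + suc (x3 + x4)
    sh = solve-∀

  -- sign change: a ↦ -a when a < 0
  sg-pre : ∀ {a} → a ℤ.< 0ℤ → ∀ z → pairInv z (- a) ≤ pairInv z a
  sg-pre {a} h z = ℕP.+-mono-≤ (ltInd-mono (ℤP.<-trans (ℤP.<-trans h (ℤP.neg-mono-< h)))) (ltInd-mono (ℤP.<-trans (ℤP.<-trans h (ℤP.neg-mono-< h))))

  inv-sw : ∀ pre a mid b post → b ℤ.< - a →
    inv (pre ++ (- b) ∷ mid ++ (- a) ∷ post) < inv (pre ++ a ∷ mid ++ b ∷ post)
  inv-sw pre a mid b post h rewrite inv-two pre (- b) mid (- a) post | inv-two pre a mid b post =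
    ℕP.+-monoʳ-< (fixed₂ pre mid post)
      (comb4 (sum2-mono (λ z → pairInv z a) (λ z → pairInv z b) (λ z → pairInv z (- b)) (λ z → pairInv z (- a)) pre (sw-pre h))
             (sw-pair h)
             (sum2-mono (pairInv a) (λ z → pairInv z b) (pairInv (- b)) (λ z → pairInv z (- a)) mid (sw-mid h))
             (sw-post a b post))

  inv-tr : ∀ pre a mid b post → b ℤ.< a →
    inv (pre ++ b ∷ mid ++ a ∷ post) < inv (pre ++ a ∷ mid ++ b ∷ post)
  inv-tr pre a mid b post h rewrite inv-two pre b mid a post | inv-two pre a mid b post =
    ℕP.+-monoʳ-< (fixed₂ pre mid post)
      (comb4 (ℕP.≤-reflexive (ℕP.+-comm (invInto pre b) (invInto pre a)))
             (tr-pair h)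
             (sum2-mono (pairInv a) (λ z → pairInv z b) (pairInv b) (λ z → pairInv z a) mid (tr-mid h))
             (ℕP.+-comm (invFrom b post) (invFrom a post)))

  inv-sg : ∀ pre a post → a ℤ.< 0ℤ → inv (pre ++ (- a) ∷ post) < inv (pre ++ a ∷ post)
  inv-sg pre a post h rewrite inv-one pre (- a) post | inv-one pre a post | invFrom-neg a post =
    ℕP.+-monoʳ-< (fixed₁ pre post)
      (ℕP.+-monoˡ-< (invFrom a post)
        (ℕP.+-mono-≤-< (sum-mono (λ z → pairInv z a) (λ z → pairInv z (- a)) pre (sg-pre h))
          (ℕP.≤-trans (ℕP.≤-reflexive (cong suc (ltInd-0 λ p → ℤP.<-asym p (ℤP.neg-mono-< h)))) (ℕP.≤-reflexive (sym (ltInd-1 h))))))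

  -- Words in the Coxeter generators.  mulWord w ws applies the generators of
  -- ws to w from the right; sw j swaps positions j+1, j+2 and bring i moves
  -- the entry in position i+1 to the front.

  sw : ∀ {m} j → j < m → Fin (suc m)
  sw j p = fsuc (fromℕ< p)

  act-sw : ∀ {m} j (p : j < m) w → act (sw j p) w ≡ swapAt j w
  act-sw j p w = cong (λ t → swapAt t w) (FinP.toℕ-fromℕ< p)

  bring : ∀ {m} i → i ≤ m → List (Fin (suc m))
  bring zero _ = []
  bring (suc i) p = sw i p ∷ bring i (ℕP.<⇒≤ p)

  bring-lem : ∀ {m} i (p : i ≤ m) pre (x : ℤ) post → length pre ≡ i →
    mulWord (pre ++ x ∷ post) (bring i p) ≡ x ∷ pre ++ post
  bring-lem zero p [] x post e = refl
  bring-lem (suc i) p pre x post e with snoc pre e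
  ... | pre' , y , refl , l =
    begin
      mulWord (act (sw i p) ((pre' ++ [ y ]) ++ x ∷ post)) (bring i (ℕP.<⇒≤ p))
    ≡⟨ cong (λ t → mulWord t (bring i (ℕP.<⇒≤ p))) (trans (act-sw i p _) (trans (cong (swapAt i) (LP.++-assoc pre' [ y ] (x ∷ post))) (subst (λ k → swapAt k (pre' ++ y ∷ x ∷ post) ≡ pre' ++ x ∷ y ∷ post) l (swapAt-mid pre' y x post)))) ⟩
      mulWord (pre' ++ x ∷ y ∷ post) (bring i (ℕP.<⇒≤ p))
    ≡⟨ bring-lem i (ℕP.<⇒≤ p) pre' x (y ∷ post) l ⟩
      x ∷ pre' ++ y ∷ post
    ≡⟨ cong (x ∷_) (sym (LP.++-assoc pre' [ y ] post)) ⟩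
      x ∷ (pre' ++ [ y ]) ++ post
    ∎
    where open ≡-Reasoning

  -- generators are involutions, so reverse ws undoes ws
  negHead-inv : ∀ w → negHead (negHead w) ≡ w
  negHead-inv [] = refl
  negHead-inv (x ∷ w) = cong (_∷ w) (ℤP.neg-involutive x)

  swapAt-inv : ∀ i w → swapAt i (swapAt i w) ≡ w
  swapAt-inv zero [] = refl
  swapAt-inv zero (x ∷ []) = refl
  swapAt-inv zero (x ∷ y ∷ w) = refl
  swapAt-inv (suc i) [] = refl
  swapAt-inv (suc i) (x ∷ w) = cong (x ∷_) (swapAt-inv i w)

  act-inv : ∀ {n} (s : Fin n) w → act s (act s w) ≡ w
  act-inv fzero w = negHead-inv w
  act-inv (fsuc i) w = swapAt-inv (toℕ i) w

  mulWord-++ : ∀ {n} w (xs ys : List (Fin n)) → mulWord w (xs ++ ys) ≡ mulWord (mulWord w xs) ys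
  mulWord-++ w xs ys = LP.foldl-++ _ w xs ys

  mulWord-∷ʳ : ∀ {n} w (xs : List (Fin n)) s → mulWord w (xs ∷ʳ s) ≡ act s (mulWord w xs)
  mulWord-∷ʳ w xs s = LP.foldl-∷ʳ _ w s xs

  mulWord-inv : ∀ {n} w (ws : List (Fin n)) → mulWord (mulWord w ws) (reverse ws) ≡ w
  mulWord-inv w [] = refl
  mulWord-inv w (s ∷ ws) =
    begin
      mulWord (mulWord (act s w) ws) (reverse (s ∷ ws))
    ≡⟨ cong (mulWord (mulWord (act s w) ws)) (LP.unfold-reverse s ws) ⟩
      mulWord (mulWord (act s w) ws) (reverse ws ∷ʳ s)
    ≡⟨ mulWord-∷ʳ _ (reverse ws) s ⟩
      act s (mulWord (mulWord (act s w) ws) (reverse ws))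
    ≡⟨ cong (act s) (mulWord-inv (act s w) ws) ⟩
      act s (act s w)
    ≡⟨ act-inv s w ⟩
      w
    ∎
    where open ≡-Reasoning

  rev-lem : ∀ {n} (v : List (Fin n)) u u' → mulWord u v ≡ u' → mulWord u' (reverse v) ≡ u
  rev-lem v u u' e = trans (cong (λ t → mulWord t (reverse v)) (sym e)) (mulWord-inv u v)

  conj : ∀ {n} x (v : List (Fin n)) s → mulWord x (v ++ s ∷ reverse v) ≡ mulWord (act s (mulWord x v)) (reverse v)
  conj x v s = mulWord-++ x v (s ∷ reverse v)

  -- Lower bound: one generator changes inv by at
  -- most one and inv(id) = 0.  Upper bound: a signed permutation with inv > 0
  -- has a negative first entry or an adjacent descent, and undoing it lowers
  -- inv by exactly one; with neither it is the identity.

  swapAt-↭ : ∀ i (w : List ℤ) → swapAt i w ↭ w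
  swapAt-↭ zero [] = Pm.refl
  swapAt-↭ zero (x ∷ []) = Pm.refl
  swapAt-↭ zero (x ∷ y ∷ w) = Pm.swap y x Pm.refl
  swapAt-↭ (suc i) [] = Pm.refl
  swapAt-↭ (suc i) (x ∷ w) = Pm.prep x (swapAt-↭ i w)

  invFrom-↭ : ∀ x {xs ys} → xs ↭ ys → invFrom x xs ≡ invFrom x ys
  invFrom-↭ x p = sum-↭ (PermP.map⁺ (pairInv x) p)

  inv-negHead : ∀ w → inv (negHead w) ≤ suc (inv w)
  inv-negHead [] = z≤n
  inv-negHead (x ∷ xs) rewrite invFrom-neg x xs =
    ℕP.+-monoˡ-≤ (inv xs) (ℕP.+-monoˡ-≤ (invFrom x xs) (ℕP.≤-trans (ltInd≤1 (- x) 0ℤ) (s≤s z≤n)))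

  pairInv-swap : ∀ x y → pairInv y x ≤ suc (pairInv x y)
  pairInv-swap x y = ℕP.≤-trans (ℕP.+-mono-≤ (ltInd≤1 x y) (ℕP.≤-reflexive (ltInd-cong flip< flip<)))
                          (s≤s (ℕP.m≤n+m (ltInd y (- x)) (ltInd y x)))

  inv-swapAt : ∀ i w → inv (swapAt i w) ≤ suc (inv w)
  inv-swapAt zero [] = z≤n
  inv-swapAt zero (x ∷ []) = ℕP.n≤1+n _
  inv-swapAt zero (x ∷ y ∷ xs) =
    ℕP.≤-trans (ℕP.≤-reflexive (sh (negInd y) (pairInv y x) (invFrom y xs) (negInd x) (invFrom x xs) (inv xs)))
      (ℕP.≤-trans (ℕP.+-monoʳ-≤ (negInd x + invFrom x xs + (negInd y + invFrom y xs + inv xs)) (pairInv-swap x y))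
        (ℕP.≤-reflexive (sh2 (negInd y) (pairInv x y) (invFrom y xs) (negInd x) (invFrom x xs) (inv xs))))
    where
    sh : ∀ a b c d e f → a + (b + c) + (d + e + f) ≡ d + e + (a + c + f) + b
    sh = solve-∀
    sh2 : ∀ a b c d e f → d + e + (a + c + f) + suc b ≡ suc (d + (b + e) + (a + c + f))
    sh2 = solve-∀
  inv-swapAt (suc i) [] = z≤n
  inv-swapAt (suc i) (x ∷ xs) rewrite invFrom-↭ x (swapAt-↭ i xs) =
    ℕP.≤-trans (ℕP.+-monoʳ-≤ (negInd x + invFrom x xs) (inv-swapAt i xs)) (ℕP.≤-reflexive (ℕP.+-suc _ _))

  inv-act : ∀ {n} (s : Fin n) w → inv (act s w) ≤ suc (inv w)
  inv-act fzero w = inv-negHead w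
  inv-act (fsuc i) w = inv-swapAt (toℕ i) w

  inv-mulWord : ∀ {n} w (ws : List (Fin n)) → inv (mulWord w ws) ≤ inv w + length ws
  inv-mulWord w [] = ℕP.m≤m+n _ _
  inv-mulWord w (s ∷ ws) = ℕP.≤-trans (inv-mulWord (act s w) ws)
    (ℕP.≤-trans (ℕP.+-monoˡ-≤ (length ws) (inv-act s w)) (ℕP.≤-reflexive (sym (ℕP.+-suc _ _))))

  invFrom-up : ∀ a b k → a ≤ b → invFrom (+ a) (map pos (upFrom b k)) ≡ 0
  invFrom-up a b zero h = refl
  invFrom-up a b (suc k) h = cong₂ _+_ (cong₂ _+_ (ltInd-0 (ℤP.≤⇒≯ (ℤ.+≤+ h))) (ltInd-0 (ℤP.≤⇒≯ (neg≤pos a b))))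
                              (invFrom-up a (suc b) k (ℕP.m≤n⇒m≤1+n h))

  inv-up : ∀ b k → inv (map pos (upFrom b k)) ≡ 0
  inv-up b zero = refl
  inv-up b (suc k) = cong₂ _+_ (cong₂ _+_ (ltInd-0 (ℤP.≤⇒≯ (ℤ.+≤+ {0} {b} z≤n))) (invFrom-up b (suc b) k (ℕP.n≤1+n b))) (inv-up (suc b) k)

  inv-identity : ∀ n → inv (identity n) ≡ 0
  inv-identity n rewrite identity-eq n = inv-up 1 n

  lower : ∀ n ws → inv (prod n ws) ≤ length ws
  lower n ws = ℕP.≤-trans (inv-mulWord (identity n) ws) (ℕP.≤-reflexive (cong (_+ length ws) (inv-identity n)))

  drop-neg : ∀ x xs → x ℤ.< 0ℤ → suc (inv ((- x) ∷ xs)) ≡ inv (x ∷ xs)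
  drop-neg x xs h rewrite invFrom-neg x xs | ltInd-0 { - x} {0ℤ} (λ p → ℤP.<-asym p (ℤP.neg-mono-< h)) | ltInd-1 h = refl

  drop-sw : ∀ pre a b post → b ℤ.< a → suc (inv (pre ++ b ∷ a ∷ post)) ≡ inv (pre ++ a ∷ b ∷ post)
  drop-sw pre a b post h rewrite inv-two pre b [] a post | inv-two pre a [] b post
    | ltInd-0 (ℤP.<-asym h) | ltInd-1 h | ltInd-cong {a} { - b} {b} { - a} flip< flip< =
    sh (fixed₂ pre [] post) (invInto pre b) (invInto pre a) (negInd b) (negInd a) (ltInd b (- a)) (invFrom b post) (invFrom a post)
    where
    sh : ∀ k x1 x2 x3 x4 x5 x6 x7 → suc (k + (x1 + x2 + (x3 + x4 + (0 + x5)) + 0 + (x6 + x7)))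
                                    ≡ k + (x2 + x1 + (x4 + x3 + (1 + x5)) + 0 + (x7 + x6))
    sh = solve-∀

  invFrom-sorted : ∀ x y ys → 0ℤ ℤ.≤ x → x ℤ.≤ y → Linked ℤ._≤_ (y ∷ ys) → invFrom x (y ∷ ys) ≡ 0
  invFrom-sorted x y [] h0 h [-] = cong (_+ 0) (cong₂ _+_ (ltInd-0 (ℤP.≤⇒≯ h)) (ltInd-0 (ℤP.≤⇒≯ (ℤP.≤-trans (ℤP.neg-mono-≤ h0) (ℤP.≤-trans h0 h)))))
  invFrom-sorted x y (z ∷ zs) h0 h (yz ∷ l) = cong₂ _+_ (cong₂ _+_ (ltInd-0 (ℤP.≤⇒≯ h)) (ltInd-0 (ℤP.≤⇒≯ (ℤP.≤-trans (ℤP.neg-mono-≤ h0) (ℤP.≤-trans h0 h)))))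
    (invFrom-sorted x z zs h0 (ℤP.≤-trans h yz) l)

  inv-sorted : ∀ w → Linked ℤ._≤_ w → All (0ℤ ℤ.≤_) w → inv w ≡ 0
  inv-sorted [] l a = refl
  inv-sorted (x ∷ []) l (h ∷ _) = cong (_+ 0) (cong (_+ 0) (ltInd-0 (ℤP.≤⇒≯ h)))
  inv-sorted (x ∷ y ∷ ys) (xy ∷ l) (h ∷ a) = cong₂ _+_ (cong₂ _+_ (ltInd-0 (ℤP.≤⇒≯ h)) (invFrom-sorted x y ys h xy l)) (inv-sorted (y ∷ ys) l a)

  data HasDescent : List ℤ → Set where
    dneg : ∀ x xs → x ℤ.< 0ℤ → HasDescent (x ∷ xs)
    dsw : ∀ pre a b post → b ℤ.< a → HasDescent (pre ++ a ∷ b ∷ post)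

  descent : ∀ w → (Linked ℤ._≤_ w × All (0ℤ ℤ.≤_) w) ⊎ HasDescent w
  descent [] = inj₁ ([] , [])
  descent (x ∷ xs) with x ℤ.<? 0ℤ
  ... | yes p = inj₂ (dneg x xs p)
  ... | no p with adj (x ∷ xs)
  ...   | inj₁ l = inj₁ (l , lk-nonneg (ℤP.≮⇒≥ p) l)
  ...   | inj₂ (pre , a , b , post , e , q) = inj₂ (subst HasDescent (sym e) (dsw pre a b post q))

  length-prefix< : ∀ {m} pre (a b : ℤ) post → length (pre ++ a ∷ b ∷ post) ≡ suc m → length pre < m
  length-prefix< {m} pre a b post e rewrite LP.length-++ pre {a ∷ b ∷ post} =
    ℕP.≤-trans (ℕP.≤-reflexive (sym (ℕP.+-comm (length pre) 1))) (ℕP.≤-trans (ℕP.m≤m+n (length pre + 1) (length post))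
      (ℕP.≤-reflexive (ℕP.suc-injective (trans (sh (length pre) (length post)) e))))
    where
    sh : ∀ x y → suc (x + 1 + y) ≡ x + suc (suc y)
    sh = solve-∀

  upper : ∀ m k w → inv w ≡ k → IsSignedPerm (suc m) w → ∃ λ ws → prod (suc m) ws ≡ w × length ws ≡ k
  upper m k w e sp with descent w
  upper m zero w e sp | inj₁ (l , a) = [] , sym (ident (suc m) w l a (proj₂ sp)) , refl
  upper m (suc k) w e sp | inj₁ (l , a) = ⊥-elim (ℕP.0≢1+n (trans (sym (inv-sorted w l a)) e))
  upper m zero .(x ∷ xs) e sp | inj₂ (dneg x xs h) = ⊥-elim (ℕP.0≢1+n (sym (trans (drop-neg x xs h) e)))
  upper m (suc k) .(x ∷ xs) e sp | inj₂ (dneg x xs h) with upper m k ((- x) ∷ xs) (ℕP.suc-injective (trans (drop-neg x xs h) e))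
                                    (SP-abs {w = x ∷ xs} {w' = (- x) ∷ xs} (abs-neg1 [] x xs) refl sp)
  ... | ws , pw , lw = ws ∷ʳ fzero ,
    trans (mulWord-∷ʳ (identity (suc m)) ws fzero) (trans (cong negHead pw) (cong (_∷ xs) (ℤP.neg-involutive x))) ,
    trans (LP.length-++ ws) (trans (ℕP.+-comm (length ws) 1) (cong suc lw))
  upper m zero .(pre ++ a ∷ b ∷ post) e sp | inj₂ (dsw pre a b post h) = ⊥-elim (ℕP.0≢1+n (sym (trans (drop-sw pre a b post h) e)))
  upper m (suc k) .(pre ++ a ∷ b ∷ post) e sp | inj₂ (dsw pre a b post h)
    with upper m k (pre ++ b ∷ a ∷ post) (ℕP.suc-injective (trans (drop-sw pre a b post h) e))
           (SP-↭ (PermP.++⁺ˡ pre (Pm.swap b a Pm.refl)) sp)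
  ... | ws , pw , lw = ws ∷ʳ s ,
    trans (mulWord-∷ʳ (identity (suc m)) ws s) (trans (cong (act s) pw) (trans (act-sw (length pre) p _) (swapAt-mid pre b a post))) ,
    trans (LP.length-++ ws) (trans (ℕP.+-comm (length ws) 1) (cong suc lw))
    where
    p = length-prefix< pre a b post (proj₁ sp)
    s = sw (length pre) p

  hasLength : ∀ m w → IsSignedPerm (suc m) w → HasLength (suc m) w (inv w)
  hasLength m w sp = upper m (inv w) w refl sp , λ ws e → subst (λ t → inv t ≤ length ws) e (lower (suc m) ws)

  -- The three kinds of reflections of B_n act on one-line
  -- notation as a transposition a,b ↦ b,a, a signed transposition
  -- a,b ↦ -b,-a, and a sign change a ↦ -a.

  mkStep : ∀ m x y (v : List (Fin (suc m))) s → y ≡ mulWord x (v ++ s ∷ reverse v) →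
    IsSignedPerm (suc m) x → IsSignedPerm (suc m) y → inv x < inv y → BruhatStep (suc m) x y
  mkStep m x y v s e spx spy x<y = (v , s , e) , (inv x , inv y , hasLength m x spx , hasLength m y spy , x<y)

  Len2 : ℕ → List ℤ → List ℤ → List ℤ → Set
  Len2 m pre mid post = length pre + suc (length mid + suc (length post)) ≡ suc m

  length-two : ∀ pre (a : ℤ) mid (b : ℤ) post → length (pre ++ a ∷ mid ++ b ∷ post) ≡ length pre + suc (length mid + suc (length post))
  length-two pre a mid b post rewrite LP.length-++ pre {a ∷ mid ++ b ∷ post} | LP.length-++ mid {b ∷ post} = refl

  module Exchange {m} (pre mid post : List ℤ) (hl : Len2 m pre mid post) where
    j = length pre + suc (length mid)

    pj : j ≤ m
    pj = ℕP.≤-trans (ℕP.m≤m+n j (length post))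
           (ℕP.≤-reflexive (ℕP.suc-injective (trans (sh (length pre) (length mid) (length post)) hl)))
      where
      sh : ∀ x y z → suc (x + suc y + z) ≡ x + suc (y + suc z)
      sh = solve-∀

    pi : suc (length pre) ≤ m
    pi = ℕP.≤-trans (ℕP.≤-trans (s≤s (ℕP.m≤m+n (length pre) (length mid))) (ℕP.≤-reflexive (sym (ℕP.+-suc (length pre) (length mid))))) pj

    p0 : 0 < m
    p0 = ℕP.≤-trans (s≤s z≤n) pi

    s1 : Fin (suc m)
    s1 = sw 0 p0

    v2 : List (Fin (suc m))
    v2 = bring j pj ++ bring (suc (length pre)) pi

    R = pre ++ mid ++ post

    -- v2 brings the two marked entries to the front
    front : ∀ a b → mulWord (pre ++ a ∷ mid ++ b ∷ post) v2 ≡ a ∷ b ∷ R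
    front a b =
      begin
        mulWord (pre ++ a ∷ mid ++ b ∷ post) v2
      ≡⟨ mulWord-++ _ (bring j pj) _ ⟩
        mulWord (mulWord (pre ++ a ∷ mid ++ b ∷ post) (bring j pj)) (bring (suc (length pre)) pi)
      ≡⟨ cong (λ t → mulWord (mulWord t (bring j pj)) (bring (suc (length pre)) pi)) (sym (LP.++-assoc pre (a ∷ mid) (b ∷ post))) ⟩
        mulWord (mulWord ((pre ++ a ∷ mid) ++ b ∷ post) (bring j pj)) (bring (suc (length pre)) pi)
      ≡⟨ cong (λ t → mulWord t (bring (suc (length pre)) pi)) (bring-lem j pj (pre ++ a ∷ mid) b post (LP.length-++ pre)) ⟩
        mulWord (b ∷ (pre ++ a ∷ mid) ++ post) (bring (suc (length pre)) pi)
      ≡⟨ cong (λ t → mulWord (b ∷ t) (bring (suc (length pre)) pi)) (trans (LP.++-assoc pre (a ∷ mid) post) refl) ⟩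
        mulWord ((b ∷ pre) ++ a ∷ (mid ++ post)) (bring (suc (length pre)) pi)
      ≡⟨ bring-lem (suc (length pre)) pi (b ∷ pre) a (mid ++ post) refl ⟩
        a ∷ b ∷ pre ++ mid ++ post
      ∎
      where open ≡-Reasoning

    word-tr : ∀ a b → pre ++ a ∷ mid ++ b ∷ post ≡ mulWord (pre ++ b ∷ mid ++ a ∷ post) (v2 ++ s1 ∷ reverse v2)
    word-tr a b = sym (trans (conj _ v2 s1)
      (trans (cong (λ t → mulWord (act s1 t) (reverse v2)) (front b a))
        (trans (cong (λ t → mulWord t (reverse v2)) (act-sw 0 p0 (b ∷ a ∷ R)))
          (rev-lem v2 _ _ (front a b)))))

    v3 : List (Fin (suc m))
    v3 = v2 ∷ʳ fzero

    word-sw : ∀ a b → pre ++ a ∷ mid ++ b ∷ post ≡ mulWord (pre ++ (- b) ∷ mid ++ (- a) ∷ post) (v3 ++ s1 ∷ reverse v3)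
    word-sw a b = sym (
      begin
        mulWord XX (v3 ++ s1 ∷ reverse v3)
      ≡⟨ conj XX v3 s1 ⟩
        mulWord (act s1 (mulWord XX v3)) (reverse v3)
      ≡⟨ cong (λ t → mulWord (act s1 t) (reverse v3)) (mulWord-∷ʳ XX v2 fzero) ⟩
        mulWord (act s1 (negHead (mulWord XX v2))) (reverse v3)
      ≡⟨ cong (λ t → mulWord (act s1 (negHead t)) (reverse v3)) (front (- b) (- a)) ⟩
        mulWord (act s1 ((- - b) ∷ (- a) ∷ R)) (reverse v3)
      ≡⟨ cong (λ t → mulWord t (reverse v3)) (act-sw 0 p0 _) ⟩
        mulWord ((- a) ∷ (- - b) ∷ R) (reverse v3)
      ≡⟨ cong (mulWord ((- a) ∷ (- - b) ∷ R)) (LP.reverse-++ v2 [ fzero ]) ⟩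
        mulWord ((- - a) ∷ (- - b) ∷ R) (reverse v2)
      ≡⟨ cong₂ (λ u t → mulWord (u ∷ t ∷ R) (reverse v2)) (ℤP.neg-involutive a) (ℤP.neg-involutive b) ⟩
        mulWord (a ∷ b ∷ R) (reverse v2)
      ≡⟨ rev-lem v2 _ _ (front a b) ⟩
        pre ++ a ∷ mid ++ b ∷ post
      ∎)
      where
      open ≡-Reasoning
      XX = pre ++ (- b) ∷ mid ++ (- a) ∷ post

  module SignFlip {m} (pre post : List ℤ) (hl : length pre + suc (length post) ≡ suc m) where
    pl : length pre ≤ m
    pl = ℕP.≤-trans (ℕP.m≤m+n (length pre) (length post)) (ℕP.≤-reflexive (ℕP.suc-injective (trans (sym (ℕP.+-suc (length pre) (length post))) hl)))

    v1 : List (Fin (suc m))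
    v1 = bring (length pre) pl

    word-sg : ∀ a → pre ++ a ∷ post ≡ mulWord (pre ++ (- a) ∷ post) (v1 ++ fzero ∷ reverse v1)
    word-sg a = sym (trans (conj _ v1 fzero)
      (trans (cong (λ t → mulWord (negHead t) (reverse v1)) (bring-lem (length pre) pl pre (- a) post refl))
        (trans (cong (λ t → mulWord (t ∷ pre ++ post) (reverse v1)) (ℤP.neg-involutive a))
          (rev-lem v1 _ _ (bring-lem (length pre) pl pre a post refl)))))

  Lowering : ℕ → List ℤ → List ℤ → Set
  Lowering m w' w = IsSignedPerm (suc m) w' × BruhatStep (suc m) w' w × inv w' < inv w

  lowerTr : ∀ m pre a mid b post → b ℤ.< a → IsSignedPerm (suc m) (pre ++ a ∷ mid ++ b ∷ post) →
    Lowering m (pre ++ b ∷ mid ++ a ∷ post) (pre ++ a ∷ mid ++ b ∷ post)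
  lowerTr m pre a mid b post h sp = sp' , mkStep m _ _ (Exchange.v2 pre mid post hl) (Exchange.s1 pre mid post hl)
      (Exchange.word-tr pre mid post hl a b) sp' sp lt0 , lt0
    where
    hl = trans (sym (length-two pre a mid b post)) (proj₁ sp)
    sp' = SP-↭ (tr-perm pre a mid b post) sp
    lt0 = inv-tr pre a mid b post h

  lowerSw : ∀ m pre a mid b post → b ℤ.< - a → IsSignedPerm (suc m) (pre ++ a ∷ mid ++ b ∷ post) →
    Lowering m (pre ++ (- b) ∷ mid ++ (- a) ∷ post) (pre ++ a ∷ mid ++ b ∷ post)
  lowerSw m pre a mid b post h sp = sp' , mkStep m _ _ (Exchange.v3 pre mid post hl) (Exchange.s1 pre mid post hl)
      (Exchange.word-sw pre mid post hl a b) sp' sp lt0 , lt0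
    where
    hl = trans (sym (length-two pre a mid b post)) (proj₁ sp)
    sp' = SP-abs {w = pre ++ b ∷ mid ++ a ∷ post} (abs2 pre a mid b post)
            (trans (length-two pre (- b) mid (- a) post) (sym (length-two pre b mid a post)))
            (SP-↭ (tr-perm pre a mid b post) sp)
    lt0 = inv-sw pre a mid b post h

  lowerSg : ∀ m pre a post → a ℤ.< 0ℤ → IsSignedPerm (suc m) (pre ++ a ∷ post) →
    Lowering m (pre ++ (- a) ∷ post) (pre ++ a ∷ post)
  lowerSg m pre a post h sp = sp' , mkStep m _ _ (SignFlip.v1 pre post hl) fzero (SignFlip.word-sg pre post hl a) sp' sp lt0 , lt0
    where
    hl = trans (sym (LP.length-++ pre {a ∷ post})) (proj₁ sp)
    sp' = SP-abs {w = pre ++ a ∷ post} (abs-neg1 pre a post) (length-replace pre (- a) a post) sp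
    lt0 = inv-sg pre a post h

  module Count (t : ℤ) where
    cnt : List ℤ → ℕ
    cnt xs = length (filter (ℤ._≤? t) xs)

    ind : ℤ → ℕ
    ind x = cnt [ x ]

    cnt-++ : ∀ xs ys → cnt (xs ++ ys) ≡ cnt xs + cnt ys
    cnt-++ xs ys rewrite LP.filter-++ (ℤ._≤? t) xs ys = LP.length-++ (filter (ℤ._≤? t) xs)

    cnt-∷ : ∀ x xs → cnt (x ∷ xs) ≡ ind x + cnt xs
    cnt-∷ x xs = cnt-++ [ x ] xs

    cnt-all : ∀ S → All (ℤ._≤ t) S → cnt S ≡ length S
    cnt-all S a = cong length (LP.filter-all (ℤ._≤? t) a)

    cnt-prefix : ∀ S Z → All (ℤ._≤ t) S → length S ≤ cnt (S ++ Z)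
    cnt-prefix S Z a rewrite cnt-++ S Z | cnt-all S a = ℕP.m≤m+n (length S) (cnt Z)

    cnt-swap : ∀ B1 a b B3 → cnt (B1 ++ b ∷ a ∷ B3) ≡ cnt (B1 ++ a ∷ b ∷ B3)
    cnt-swap B1 a b B3 rewrite cnt-++ B1 (b ∷ a ∷ B3) | cnt-++ B1 (a ∷ b ∷ B3)
      | cnt-∷ b (a ∷ B3) | cnt-∷ a B3 | cnt-∷ a (b ∷ B3) | cnt-∷ b B3 = sh (cnt B1) (ind a) (ind b) (cnt B3)
      where
      sh : ∀ x y z u → x + (z + (y + u)) ≡ x + (y + (z + u))
      sh = solve-∀

  cnt-split : ∀ t X Y → All (ℤ._≤ t) X → All (t ℤ.<_) Y → Count.cnt t (X ++ Y) ≡ length X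
  cnt-split t X Y ax ay rewrite Count.cnt-++ t X Y | LP.filter-all (ℤ._≤? t) ax
    | LP.filter-none (ℤ._≤? t) (All.map (λ h h' → ℤP.<-irrefl refl (ℤP.<-≤-trans h h')) ay) = ℕP.+-identityʳ (length X)

  rank-AB : ∀ P (A B : List ℤ) q → length A ≡ P → rank (A ++ B) (suc P) q ≡ Count.cnt (- q) B
  rank-AB P A B q refl = cong (λ z → length (filter (ℤ._≤? (- q)) z)) (drop-len A B)

  RankLowering : ℕ → ℕ → ℕ → ℤ → List ℤ → Set
  RankLowering m k p q w = ∃ λ w' → IsSignedPerm (suc m) w' × k ≤ rank w' p q × BruhatStep (suc m) w' w × inv w' < inv w

  rankLowering : ∀ {m} k p q {w w'} → Lowering m w' w → k ≤ rank w' p q → RankLowering m k p q w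
  rankLowering k p q {w' = w'} (sp , st , lt) r = w' , sp , r , st , lt

  RankLowering-subst : ∀ {m k p q w v} → v ≡ w → RankLowering m k p q v → RankLowering m k p q w
  RankLowering-subst refl d = d

  module Moves (m k P : ℕ) (q : ℤ) where
    open Count (- q)

    mA-tr : ∀ A1 a b A2 B → b ℤ.< a → length (A1 ++ a ∷ b ∷ A2) ≡ P → k ≤ cnt B →
      IsSignedPerm (suc m) ((A1 ++ a ∷ b ∷ A2) ++ B) → RankLowering m k (suc P) q ((A1 ++ a ∷ b ∷ A2) ++ B)
    mA-tr A1 a b A2 B h l r sp =
      RankLowering-subst {m} {k} {suc P} {q} (sym e) (rankLowering k (suc P) q (lowerTr m A1 a [] b (A2 ++ B) h (subst (IsSignedPerm (suc m)) e sp))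
        (subst (k ≤_) (sym (trans (cong (λ z → rank z (suc P) q) e') (rank-AB P (A1 ++ b ∷ a ∷ A2) B q l'))) r))
      where
      e : (A1 ++ a ∷ b ∷ A2) ++ B ≡ A1 ++ a ∷ b ∷ A2 ++ B
      e = LP.++-assoc A1 (a ∷ b ∷ A2) B
      e' : A1 ++ b ∷ a ∷ A2 ++ B ≡ (A1 ++ b ∷ a ∷ A2) ++ B
      e' = sym (LP.++-assoc A1 (b ∷ a ∷ A2) B)
      l' : length (A1 ++ b ∷ a ∷ A2) ≡ P
      l' = trans (LP.length-++ A1) (trans (sym (LP.length-++ A1)) l)

    mA-sg : ∀ a A2 B → a ℤ.< 0ℤ → length (a ∷ A2) ≡ P → k ≤ cnt B →
      IsSignedPerm (suc m) ((a ∷ A2) ++ B) → RankLowering m k (suc P) q ((a ∷ A2) ++ B)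
    mA-sg a A2 B h l r sp = rankLowering k (suc P) q (lowerSg m [] a (A2 ++ B) h sp)
        (subst (k ≤_) (sym (rank-AB P ((- a) ∷ A2) B q l)) r)

    mB-tr : ∀ A B1 a B2 b B3 → b ℤ.< a → length A ≡ P → k ≤ cnt (B1 ++ b ∷ B2 ++ a ∷ B3) →
      IsSignedPerm (suc m) (A ++ B1 ++ a ∷ B2 ++ b ∷ B3) → RankLowering m k (suc P) q (A ++ B1 ++ a ∷ B2 ++ b ∷ B3)
    mB-tr A B1 a B2 b B3 h l r sp =
      RankLowering-subst {m} {k} {suc P} {q} (sym e) (rankLowering k (suc P) q (lowerTr m (A ++ B1) a B2 b B3 h (subst (IsSignedPerm (suc m)) e sp))
        (subst (k ≤_) (sym (trans (cong (λ z → rank z (suc P) q) (LP.++-assoc A B1 _)) (rank-AB P A (B1 ++ b ∷ B2 ++ a ∷ B3) q l))) r))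
      where
      e : A ++ B1 ++ a ∷ B2 ++ b ∷ B3 ≡ (A ++ B1) ++ a ∷ B2 ++ b ∷ B3
      e = sym (LP.++-assoc A B1 _)

    mB-sw : ∀ A B1 a B2 b B3 → b ℤ.< - a → length A ≡ P → k ≤ cnt (B1 ++ (- b) ∷ B2 ++ (- a) ∷ B3) →
      IsSignedPerm (suc m) (A ++ B1 ++ a ∷ B2 ++ b ∷ B3) → RankLowering m k (suc P) q (A ++ B1 ++ a ∷ B2 ++ b ∷ B3)
    mB-sw A B1 a B2 b B3 h l r sp =
      RankLowering-subst {m} {k} {suc P} {q} (sym e) (rankLowering k (suc P) q (lowerSw m (A ++ B1) a B2 b B3 h (subst (IsSignedPerm (suc m)) e sp))
        (subst (k ≤_) (sym (trans (cong (λ z → rank z (suc P) q) (LP.++-assoc A B1 _)) (rank-AB P A (B1 ++ (- b) ∷ B2 ++ (- a) ∷ B3) q l))) r))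
      where
      e : A ++ B1 ++ a ∷ B2 ++ b ∷ B3 ≡ (A ++ B1) ++ a ∷ B2 ++ b ∷ B3
      e = sym (LP.++-assoc A B1 _)

    mB-sg : ∀ A B1 a B2 → a ℤ.< 0ℤ → length A ≡ P → k ≤ cnt (B1 ++ (- a) ∷ B2) →
      IsSignedPerm (suc m) (A ++ B1 ++ a ∷ B2) → RankLowering m k (suc P) q (A ++ B1 ++ a ∷ B2)
    mB-sg A B1 a B2 h l r sp =
      RankLowering-subst {m} {k} {suc P} {q} (sym e) (rankLowering k (suc P) q (lowerSg m (A ++ B1) a B2 h (subst (IsSignedPerm (suc m)) e sp))
        (subst (k ≤_) (sym (trans (cong (λ z → rank z (suc P) q) (LP.++-assoc A B1 _)) (rank-AB P A (B1 ++ (- a) ∷ B2) q l))) r))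
      where
      e : A ++ B1 ++ a ∷ B2 ≡ (A ++ B1) ++ a ∷ B2
      e = sym (LP.++-assoc A B1 _)

    mX-tr : ∀ A1 a A2 B1 b B2 → b ℤ.< a → length (A1 ++ a ∷ A2) ≡ P → k ≤ cnt (B1 ++ a ∷ B2) →
      IsSignedPerm (suc m) ((A1 ++ a ∷ A2) ++ B1 ++ b ∷ B2) → RankLowering m k (suc P) q ((A1 ++ a ∷ A2) ++ B1 ++ b ∷ B2)
    mX-tr A1 a A2 B1 b B2 h l r sp =
      RankLowering-subst {m} {k} {suc P} {q} (sym e) (rankLowering k (suc P) q (lowerTr m A1 a (A2 ++ B1) b B2 h (subst (IsSignedPerm (suc m)) e sp))
        (subst (k ≤_) (sym (trans (cong (λ z → rank z (suc P) q) (e2 b a)) (rank-AB P (A1 ++ b ∷ A2) (B1 ++ a ∷ B2) q l'))) r))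
      where
      e2 : ∀ (x y : ℤ) → A1 ++ x ∷ (A2 ++ B1) ++ y ∷ B2 ≡ (A1 ++ x ∷ A2) ++ B1 ++ y ∷ B2
      e2 x y = trans (cong (λ z → A1 ++ x ∷ z) (LP.++-assoc A2 B1 (y ∷ B2))) (sym (LP.++-assoc A1 (x ∷ A2) _))
      e : (A1 ++ a ∷ A2) ++ B1 ++ b ∷ B2 ≡ A1 ++ a ∷ (A2 ++ B1) ++ b ∷ B2
      e = sym (e2 a b)
      l' : length (A1 ++ b ∷ A2) ≡ P
      l' = trans (LP.length-++ A1) (trans (sym (LP.length-++ A1)) l)

    mX-sw : ∀ A1 a A2 B1 b B2 → b ℤ.< - a → length (A1 ++ a ∷ A2) ≡ P → k ≤ cnt (B1 ++ (- a) ∷ B2) →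
      IsSignedPerm (suc m) ((A1 ++ a ∷ A2) ++ B1 ++ b ∷ B2) → RankLowering m k (suc P) q ((A1 ++ a ∷ A2) ++ B1 ++ b ∷ B2)
    mX-sw A1 a A2 B1 b B2 h l r sp =
      RankLowering-subst {m} {k} {suc P} {q} (sym e) (rankLowering k (suc P) q (lowerSw m A1 a (A2 ++ B1) b B2 h (subst (IsSignedPerm (suc m)) e sp))
        (subst (k ≤_) (sym (trans (cong (λ z → rank z (suc P) q) (e2 (- b) (- a))) (rank-AB P (A1 ++ (- b) ∷ A2) (B1 ++ (- a) ∷ B2) q l'))) r))
      where
      e2 : ∀ (x y : ℤ) → A1 ++ x ∷ (A2 ++ B1) ++ y ∷ B2 ≡ (A1 ++ x ∷ A2) ++ B1 ++ y ∷ B2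
      e2 x y = trans (cong (λ z → A1 ++ x ∷ z) (LP.++-assoc A2 B1 (y ∷ B2))) (sym (LP.++-assoc A1 (x ∷ A2) _))
      e : (A1 ++ a ∷ A2) ++ B1 ++ b ∷ B2 ≡ A1 ++ a ∷ (A2 ++ B1) ++ b ∷ B2
      e = sym (e2 a b)
      l' : length (A1 ++ (- b) ∷ A2) ≡ P
      l' = trans (LP.length-++ A1) (trans (sym (LP.length-++ A1)) l)

  -- In one-line notation w(k,p,q) = A ++ block k q ++ Y
  -- where A ++ Y lists the remaining values increasingly; block k q is one
  -- run (q > 0, or q < 0 with k ≤ |q|) or a negative run followed by a
  -- positive run (q < 0, k > |q|).

  usedL : ℕ → ℤ → List ℕ
  usedL k q = map ∣_∣ (block k q)

  restL : ℕ → ℕ → ℤ → List ℤ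
  restL k p q = map +_ (filter (λ v → ¬? (v ∈? usedL k q)) (range 1 (bigN k p q)))

  extL : ℕ → ℕ → ℕ → ℤ → List ℤ
  extL n k p q = map +_ (range (suc (bigN k p q)) n)

  -- If A ++ Y is sorted and positive and X = block k q, then A ++ X ++ Y is
  -- w(k,p,q): A ++ Y must then consist of the values 1..n not used by the block.
  module Terminal (m k P : ℕ) (q : ℤ) (Nn : bigN k (suc P) q ≤ suc m) where
    n = suc m
    N = bigN k (suc P) q
    used = usedL k q
    rest = restL k (suc P) q
    ext = extL n k (suc P) q
    RR = rest ++ ext

    rest-AP : AllPairs ℤ._<_ rest
    rest-AP = APP.map⁺ (AP.map ℤ.+<+ (APP.filter⁺ (λ v → ¬? (v ∈? used)) (subst (AllPairs _<_) (sym (range-eq 1 N)) (upFrom-AP 1 N))))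

    ext-AP : AllPairs ℤ._<_ ext
    ext-AP = APP.map⁺ (AP.map ℤ.+<+ (subst (AllPairs _<_) (sym (range-eq (suc N) n)) (upFrom-AP (suc N) (n ∸ N))))

    rest-mem : ∀ {v} → v ∈ rest → ∃ λ u → v ≡ + u × 1 ≤ u × u ≤ N × u ∉ used
    rest-mem p with MP.∈-map⁻ +_ p
    ... | u , mu , e with MP.∈-filter⁻ (λ v → ¬? (v ∈? used)) mu
    ...   | mr , nu with ∈-upFrom⁻ 1 N (subst (u ∈_) (range-eq 1 N) mr)
    ...     | h1 , h2 = u , e , h1 , ℕP.≤-pred h2 , nu

    ext-mem : ∀ {v} → v ∈ ext → ∃ λ u → v ≡ + u × N < u × u ≤ n
    ext-mem p with MP.∈-map⁻ +_ p
    ... | u , mu , e with ∈-upFrom⁻ (suc N) (n ∸ N) (subst (u ∈_) (range-eq (suc N) n) mu)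
    ...   | h1 , h2 = u , e , h1 , ℕP.≤-pred (ℕP.≤-trans h2 (ℕP.≤-reflexive (cong suc (ℕP.m+[n∸m]≡n Nn))))

    RR-AP : AllPairs ℤ._<_ RR
    RR-AP = APP.++⁺ rest-AP ext-AP (All.tabulate λ {x} mx → All.tabulate λ {y} my → lem mx my)
      where
      lem : ∀ {x y} → x ∈ rest → y ∈ ext → x ℤ.< y
      lem mx my with rest-mem mx | ext-mem my
      ... | u , refl , _ , h , _ | u' , refl , h' , _ = ℤ.+<+ (ℕP.≤-<-trans h h')

    term : ∀ A X Y → IsSignedPerm n (A ++ X ++ Y) → length A ≡ P → X ≡ block k q →
           Linked ℤ._<_ (A ++ Y) → All (0ℤ ℤ.<_) (A ++ Y) → P + k ≤ N →
           (∀ {z} → z ∈ block k q → ∣ z ∣ ≤ N) → length X ≡ k →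
           A ++ X ++ Y ≡ basic n k (suc P) q
    term A X Y sp lA eX lkAY posAY PkN ub lX = final
      where
      dis = SP-dis sp

      f : ∀ {v} → v ∈ A ++ Y → v ∈ RR
      f {v} mv with ∣ v ∣ ℕ.≤? N
      ... | yes le = MP.∈-++⁺ˡ (subst (_∈ rest) (sym (pos-form pv)) (MP.∈-map⁺ +_ (MP.∈-filter⁺ (λ v → ¬? (v ∈? used))
                        (subst (∣ v ∣ ∈_) (sym (range-eq 1 N)) (∈-upFrom⁺ 1 N (proj₁ rng) (s≤s le))) nu)))
        where
        pv = All.lookup posAY mv
        rng = SP-range sp (∈-++-mid A X Y mv)
        nu : ∣ v ∣ ∉ used
        nu mu with MP.∈-map⁻ ∣_∣ mu
        ... | z , mz , e = disj A X Y dis mv (subst (z ∈_) (sym eX) mz) e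
      ... | no gt = MP.∈-++⁺ʳ rest (subst (_∈ ext) (sym (pos-form pv)) (MP.∈-map⁺ +_
                       (subst (∣ v ∣ ∈_) (sym (range-eq (suc N) n)) (∈-upFrom⁺ (suc N) (n ∸ N) (ℕP.≰⇒> gt) (s≤s (ℕP.≤-trans (proj₂ rng) (ℕP.≤-reflexive (sym (ℕP.m+[n∸m]≡n Nn)))))))))
        where
        pv = All.lookup posAY mv
        rng = SP-range sp (∈-++-mid A X Y mv)

      g-aux : ∀ {v} u → v ≡ + u → 1 ≤ u → u ≤ n → u ∉ used → v ∈ A ++ Y
      g-aux {v} u ev h1 h2 nu with SP-find sp h1 h2
      ... | e' , me' , ae with MP.∈-++⁻ A me'
      ...   | inj₁ ma = MP.∈-++⁺ˡ (subst (_∈ A) (trans (pos-form (All.lookup posAY (MP.∈-++⁺ˡ ma))) (trans (cong +_ ae) (sym ev))) ma)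
      ...   | inj₂ mxy with MP.∈-++⁻ X mxy
      ...     | inj₁ mx = ⊥-elim (nu (subst (_∈ used) ae (MP.∈-map⁺ ∣_∣ (subst (e' ∈_) eX mx))))
      ...     | inj₂ my = MP.∈-++⁺ʳ A (subst (_∈ Y) (trans (pos-form (All.lookup posAY (MP.∈-++⁺ʳ A my))) (trans (cong +_ ae) (sym ev))) my)

      g : ∀ {v} → v ∈ RR → v ∈ A ++ Y
      g {v} mv with MP.∈-++⁻ rest mv
      ... | inj₁ mr with rest-mem mr
      ...   | u , ev , h1 , h2 , nu = g-aux u ev h1 (ℕP.≤-trans h2 Nn) nu
      g {v} mv | inj₂ me with ext-mem me
      ... | u , ev , h1 , h2 = g-aux u ev (ℕP.≤-trans (s≤s z≤n) h1) h2
             (λ mu → case-used mu)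
        where
        case-used : u ∈ used → ⊥
        case-used mu with MP.∈-map⁻ ∣_∣ mu
        ... | z , mz , e = ℕP.<-irrefl refl (ℕP.<-≤-trans h1 (subst (_≤ N) (sym e) (ub mz)))

      AYR : A ++ Y ≡ RR
      AYR = sorted-unique (A ++ Y) RR lkAY (LkP.AllPairs⇒Linked RR-AP) f g

      lext : length ext ≡ n ∸ N
      lext = trans (LP.length-map +_ (range (suc N) n)) (LP.length-applyUpTo _ (n ∸ N))

      l1 : P + length Y ≡ length rest + (n ∸ N)
      l1 = trans (cong (_+ length Y) (sym lA)) (trans (sym (LP.length-++ A)) (trans (cong length AYR) (trans (LP.length-++ rest) (cong (λ z → length rest ℕ.+ z) lext))))

      l2 : P + (k + length Y) ≡ n
      l2 = trans (cong₂ _+_ (sym lA) (cong (_+ length Y) (sym lX))) (trans (cong (λ z → length A ℕ.+ z) (sym (LP.length-++ X))) (trans (sym (LP.length-++ A)) (proj₁ sp)))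

      l3 : length rest + k ≡ N
      l3 = ℕP.+-cancelʳ-≡ (n ∸ N) (length rest + k) N
        (trans (sh (length rest) k (n ∸ N)) (trans (cong (_+ k) (sym l1)) (trans (sh2 P (length Y) k) (trans l2 (sym (ℕP.m+[n∸m]≡n Nn))))))
        where
        sh : ∀ a b c → a + b + c ≡ a + c + b
        sh = solve-∀
        sh2 : ∀ a b c → a + b + c ≡ a + (c + b)
        sh2 = solve-∀

      Prest : P ≤ length rest
      Prest = ℕP.+-cancelʳ-≤ k P (length rest) (ℕP.≤-trans PkN (ℕP.≤-reflexive (sym l3)))

      final : A ++ X ++ Y ≡ basic n k (suc P) q
      final =
        begin
          A ++ X ++ Y
        ≡⟨ cong₂ (λ u v → u ++ X ++ v) (sym (trans (cong (λ z → take z (A ++ Y)) (sym lA)) (take-len A Y))) (sym (trans (cong (λ z → drop z (A ++ Y)) (sym lA)) (drop-len A Y))) ⟩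
          take P (A ++ Y) ++ X ++ drop P (A ++ Y)
        ≡⟨ cong₂ (λ u v → take P u ++ v ++ drop P u) AYR eX ⟩
          take P RR ++ block k q ++ drop P RR
        ≡⟨ cong₂ (λ u v → u ++ block k q ++ v) (take-++ P rest ext Prest) (drop-++ P rest ext Prest) ⟩
          take P rest ++ block k q ++ (drop P rest ++ ext)
        ≡⟨ cong (take P rest ++_) (sym (LP.++-assoc (block k q) (drop P rest) ext)) ⟩
          take P rest ++ (block k q ++ drop P rest) ++ ext
        ≡⟨ sym (LP.++-assoc (take P rest) _ ext) ⟩
          (take P rest ++ block k q ++ drop P rest) ++ ext
        ≡⟨⟩
          basic n k (suc P) q
        ∎
        where
        open ≡-Reasoning

  blockP : ∀ k Q' → block k (+ suc Q') ≡ runU (- (+ suc Q')) k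
  blockP k Q' = trans (LP.map-applyUpTo (λ j → j) _ k)
    (AU _ k _ (λ j jl → trans (cong (λ z → - (+ z)) (ar k j jl)) (sym (low-neg (suc Q') (k ∸ 1 ∸ j)))))
    where
    ar : ∀ k j → j < k → suc Q' ℕ.+ k ∸ 1 ∸ j ≡ suc Q' + (k ∸ 1 ∸ j)
    ar (suc k') j (s≤s jl) = trans (cong (_∸ j) (ℕP.+-suc Q' k')) (ℕP.+-∸-assoc (suc Q') jl)

  negRev : ∀ a L → map (λ i → - (+ i)) (reverse (upFrom (suc a) L)) ≡ runU (- (+ suc a)) L
  negRev a zero = refl
  negRev a (suc L) = trans (cong (λ z → map (λ i → - (+ i)) (reverse z)) (upFrom-snoc (suc a) L))
    (trans (cong (map (λ i → - (+ i))) (LP.reverse-++ (upFrom (suc a) L) [ suc a + L ]))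
      (cong₂ _∷_ (sym (low-neg (suc a) L)) (negRev a L)))

  posRun : ∀ a L → map pos (upFrom (suc a) L) ≡ runU (+ (a + L)) L
  posRun a zero = refl
  posRun a (suc L) = cong₂ _∷_ (sym (trans (cong (λ z → low (+ z) L) (ℕP.+-suc a L)) (low-pos (suc a) L)))
    (trans (posRun (suc a) L) (cong (λ z → runU (+ z) L) (sym (ℕP.+-suc a L))))

  blockN1 : ∀ k M' → suc M' < k → block k -[1+ M' ] ≡ runU (- (+ suc (suc M'))) (k ∸ suc M') ++ runU (+ suc M') (suc M')
  blockN1 k M' lt with suc M' ℕ.<? k
  ... | no nlt = ⊥-elim (nlt lt)
  ... | yes _ = cong₂ _++_ (trans (cong (λ z → map (λ i → - (+ i)) (reverse z)) (range-eq (suc (suc M')) k)) (negRev (suc M') (k ∸ suc M')))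
                            (trans (cong (map pos) (range-eq 1 (suc M'))) (posRun 0 (suc M')))

  blockN2 : ∀ k M' → ¬ (suc M' < k) → block k -[1+ M' ] ≡ runU (+ suc M') k
  blockN2 k M' nlt with suc M' ℕ.<? k
  ... | yes lt = ⊥-elim (nlt lt)
  ... | no _ = trans (cong (map pos) (range-eq (suc M' ∸ k ℕ.+ 1) (suc M')))
                  (trans (cong (λ z → map pos (upFrom z (suc (suc M') ∸ z))) (ℕP.+-comm (suc M' ∸ k) 1))
                    (trans (cong (λ z → map pos (upFrom (suc (suc M' ∸ k)) z)) cnt)
                      (trans (posRun (suc M' ∸ k) k) (cong (λ z → runU (+ z) k) (ℕP.m∸n+n≡m kle)))))
    where
    kle : k ≤ suc M'
    kle = ℕP.≮⇒≥ nlt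
    cnt : suc (suc M') ∸ suc (suc M' ∸ k) ≡ k
    cnt = ℕP.m∸[m∸n]≡n kle

  module Reduction (m k P : ℕ) (q : ℤ) where
    n = suc m
    t = - q
    open Moves m k P q
    open Count t

    Reducible : List ℤ → Set
    Reducible w = RankLowering m k (suc P) q w ⊎ (w ≡ basic n k (suc P) q)

    Reducible-subst : ∀ {v w} → v ≡ w → Reducible v → Reducible w
    Reducible-subst refl x = x

    -- If more than k entries of the suffix are ≤ t, the first of them, when
    -- negative, can change sign: the other ones still give rank ≥ k.
    surplus : ∀ A x X' Y → IsSignedPerm n (A ++ (x ∷ X') ++ Y) → length A ≡ P → k < length (x ∷ X') →
      x ℤ.< 0ℤ → All (ℤ._≤ t) X' → Reducible (A ++ (x ∷ X') ++ Y)
    surplus A x X' Y sp lA gt x<0 aX' = inj₁ (mB-sg A [] x (X' ++ Y) x<0 lA rank' sp)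
      where
      rank' : k ≤ cnt ((- x) ∷ X' ++ Y)
      rank' = ℕP.≤-trans (ℕP.≤-pred gt) (ℕP.≤-trans (cnt-prefix X' Y aX')
                (ℕP.≤-trans (ℕP.m≤n+m (cnt (X' ++ Y)) (ind (- x))) (ℕP.≤-reflexive (sym (cnt-∷ (- x) (X' ++ Y))))))

    -- Either the last entry of A exceeds the first of Y (a transposition
    -- lowers w) or A ++ Y is sorted and w = w(k,p,q).
    finish : ∀ A X Y → IsSignedPerm n (A ++ X ++ Y) → length A ≡ P → k ≤ length X → length X ≡ k →
      All (ℤ._≤ t) X → X ≡ block k q →
      Linked ℤ._<_ A → All (0ℤ ℤ.<_) A → Linked ℤ._<_ Y → All (0ℤ ℤ.<_) Y →
      (Nn : bigN k (suc P) q ≤ n) → P + k ≤ bigN k (suc P) q → (∀ {z} → z ∈ block k q → ∣ z ∣ ≤ bigN k (suc P) q) →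
      Reducible (A ++ X ++ Y)
    finish A X Y sp lA r lX aX eX lkA posA lkY posY Nn PkN ub with lastView A
    ... | inj₁ refl = inj₂ (Terminal.term m k P q Nn [] X Y sp lA eX lkY posY PkN ub lX)
    ... | inj₂ (A' , a , refl) with Y
    ...   | [] = inj₂ (Terminal.term m k P q Nn (A' ++ [ a ]) X [] sp lA eX
                   (subst (Linked ℤ._<_) (sym (LP.++-identityʳ _)) lkA) (subst (All (0ℤ ℤ.<_)) (sym (LP.++-identityʳ _)) posA) PkN ub lX)
    ...   | y ∷ Y' with y ℤ.<? a
    ...     | yes ya = inj₁ (mX-tr A' a [] X y Y' ya lA (ℕP.≤-trans r (cnt-prefix X (a ∷ Y') aX)) sp)
    ...     | no nya = inj₂ (Terminal.term m k P q Nn (A' ++ [ a ]) X (y ∷ Y') sp lA eX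
                   (lk-join A' a (y ∷ Y') lkA lkY (ay ∷ All.map (ℤP.<-trans ay) (lk-all< lkY)))
                   (AllP.++⁺ posA posY) PkN ub lX)
      where
      ay : a ℤ.< y
      ay = ℤP.≤∧≢⇒< (ℤP.≮⇒≥ nya) (disAY (A' ++ [ a ]) X (y ∷ Y') (SP-dis sp) (MP.∈-++⁺ʳ A' (here refl)) (here refl))

    -- A descent inside A or inside B, or a negative entry of
    -- A, gives a lowering that does not change the entries of B as a set;
    -- otherwise A is increasing and positive and B is increasing.
    SortedSuffix : Set
    SortedSuffix = ∀ A B → IsSignedPerm n (A ++ B) → length A ≡ P → k ≤ cnt B →
          Linked ℤ._<_ A → All (0ℤ ℤ.<_) A → Linked ℤ._≤_ B → Linked ℤ._<_ B → Reducible (A ++ B)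

    sortSuffix : ∀ A B → IsSignedPerm n (A ++ B) → length A ≡ P → k ≤ cnt B →
          Linked ℤ._<_ A → All (0ℤ ℤ.<_) A → SortedSuffix → Reducible (A ++ B)
    sortSuffix A B sp lA r lkA posA sortedCase with adj B
    ... | inj₂ (pre , a , b , post , e , lt) =
          inj₁ (RankLowering-subst {m} {k} {suc P} {q} (cong (A ++_) (sym e))
            (mB-tr A pre a [] b post lt lA (subst (k ≤_) (trans (cong cnt e) (sym (cnt-swap pre a b post))) r)
              (subst (λ z → IsSignedPerm n (A ++ z)) e sp)))
    ... | inj₁ lkB≤ = sortedCase A B sp lA r lkA posA lkB≤ (strictify B lkB≤ (proj₁ (proj₂ (AP-++⁻ A B (SP-dis sp)))))

    sortPrefix : ∀ A B → IsSignedPerm n (A ++ B) → length A ≡ P → k ≤ cnt B → SortedSuffix → Reducible (A ++ B)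
    sortPrefix A B sp lA r sortedCase with adj A
    ... | inj₂ (pre , a , b , post , e , lt) =
          inj₁ (RankLowering-subst {m} {k} {suc P} {q} (cong (_++ B) (sym e))
            (mA-tr pre a b post B lt (trans (cong length (sym e)) lA) r (subst (λ z → IsSignedPerm n (z ++ B)) e sp)))
    ... | inj₁ lkA≤ with A
    ...   | [] = sortSuffix [] B sp lA r [] [] sortedCase
    ...   | x ∷ A' with 0ℤ ℤ.≤? x
    ...     | no h = inj₁ (mA-sg x A' B (ℤP.≰⇒> h) lA r sp)
    ...     | yes h = sortSuffix (x ∷ A') B sp lA r (strictify (x ∷ A') lkA≤ (proj₁ (AP-++⁻ (x ∷ A') B (SP-dis sp))))
                       (All.tabulate (λ {v} mv → nonzero-pos (All.lookup (lk-nonneg h lkA≤) mv)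
                          (proj₁ (SP-range sp (MP.∈-++⁺ˡ mv))))) sortedCase

    SplitSuffix : Set
    SplitSuffix = ∀ A X Y → IsSignedPerm n (A ++ X ++ Y) → length A ≡ P → k ≤ length X →
          Linked ℤ._<_ A → All (0ℤ ℤ.<_) A → Linked ℤ._<_ X → Linked ℤ._<_ Y →
          All (ℤ._≤ t) X → All (t ℤ.<_) Y → Reducible (A ++ X ++ Y)

    splitSuffix : SplitSuffix → SortedSuffix
    splitSuffix splitCase A B sp lA r lkA posA lkB≤ lkB with split t B lkB≤
    ... | X , Y , e , aX , aY =
      Reducible-subst (cong (A ++_) (sym e))
        (splitCase A X Y (subst (λ z → IsSignedPerm n (A ++ z)) e sp) lA (subst (k ≤_) (trans (cong cnt e) (cnt-split t X Y aX aY)) r)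
          lkA posA (lk-++ˡ X (subst (Linked ℤ._<_) e lkB)) (lk-++ʳ X (subst (Linked ℤ._<_) e lkB)) aX aY)

  module GapMoves (m k P : ℕ) (q : ℤ) where
    open Reduction m k P q
    open Moves m k P q
    open Count t

    module At (A X Y : List ℤ) (sp : IsSignedPerm n (A ++ X ++ Y)) (lA : length A ≡ P) (r : k ≤ length X)
               (aX : All (ℤ._≤ t) X) where

      module Around {x} (mx : x ∈ X) where
        decX = MP.∈-∃++ mx
        X1 = proj₁ decX
        X2 = proj₁ (proj₂ decX)
        eX : X ≡ X1 ++ [ x ] ++ X2
        eX = proj₂ (proj₂ decX)
        lenX' : ∀ v → k ≤ length (X1 ++ v ∷ X2)
        lenX' v = ℕP.≤-trans r (ℕP.≤-reflexive (trans (cong length eX) (length-replace X1 x v X2)))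
        sm : ∀ v → v ℤ.≤ t → All (ℤ._≤ t) (X1 ++ v ∷ X2)
        sm v h = All-mid X1 x X2 v (subst (All (ℤ._≤ t)) eX aX) h

      swA : ∀ {e x} → e ∈ A → x ∈ X → x ℤ.< - e → - e ℤ.≤ t → Reducible (A ++ X ++ Y)
      swA {e} {x} ea mx cond small = Reducible-subst (sym wEq) (inj₁ (mX-sw A1 e A2 X1 x (X2 ++ Y) cond lA' r' (subst (IsSignedPerm n) wEq sp)))
        where
        open Around mx
        decA = MP.∈-∃++ ea
        A1 = proj₁ decA
        A2 = proj₁ (proj₂ decA)
        eA : A ≡ A1 ++ [ e ] ++ A2
        eA = proj₂ (proj₂ decA)
        lA' : length (A1 ++ e ∷ A2) ≡ P
        lA' = trans (cong length (sym eA)) lA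
        r' : k ≤ cnt (X1 ++ (- e) ∷ X2 ++ Y)
        r' = ℕP.≤-trans (lenX' (- e)) (ℕP.≤-trans (cnt-prefix (X1 ++ (- e) ∷ X2) Y (sm (- e) small)) (ℕP.≤-reflexive (cong cnt (LP.++-assoc X1 ((- e) ∷ X2) Y))))
        wEq : A ++ X ++ Y ≡ (A1 ++ e ∷ A2) ++ X1 ++ x ∷ (X2 ++ Y)
        wEq = trans (cong₂ (λ a b → a ++ b ++ Y) eA eX) (cong ((A1 ++ e ∷ A2) ++_) (LP.++-assoc X1 (x ∷ X2) Y))

      trA : ∀ {e x} → e ∈ A → x ∈ X → x ℤ.< e → e ℤ.≤ t → Reducible (A ++ X ++ Y)
      trA {e} {x} ea mx cond small = Reducible-subst (sym wEq) (inj₁ (mX-tr A1 e A2 X1 x (X2 ++ Y) cond lA' r' (subst (IsSignedPerm n) wEq sp)))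
        where
        open Around mx
        decA = MP.∈-∃++ ea
        A1 = proj₁ decA
        A2 = proj₁ (proj₂ decA)
        eA : A ≡ A1 ++ [ e ] ++ A2
        eA = proj₂ (proj₂ decA)
        lA' : length (A1 ++ e ∷ A2) ≡ P
        lA' = trans (cong length (sym eA)) lA
        r' : k ≤ cnt (X1 ++ e ∷ X2 ++ Y)
        r' = ℕP.≤-trans (lenX' e) (ℕP.≤-trans (cnt-prefix (X1 ++ e ∷ X2) Y (sm e small)) (ℕP.≤-reflexive (cong cnt (LP.++-assoc X1 (e ∷ X2) Y))))
        wEq : A ++ X ++ Y ≡ (A1 ++ e ∷ A2) ++ X1 ++ x ∷ (X2 ++ Y)
        wEq = trans (cong₂ (λ a b → a ++ b ++ Y) eA eX) (cong ((A1 ++ e ∷ A2) ++_) (LP.++-assoc X1 (x ∷ X2) Y))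

      swY : ∀ {e x} → e ∈ Y → x ∈ X → e ℤ.< - x → - e ℤ.≤ t → Reducible (A ++ X ++ Y)
      swY {e} {x} ey mx cond small = Reducible-subst (sym wEq) (inj₁ (mB-sw A X1 x (X2 ++ Y1) e Y2 cond lA r' (subst (IsSignedPerm n) wEq sp)))
        where
        open Around mx
        decY = MP.∈-∃++ ey
        Y1 = proj₁ decY
        Y2 = proj₁ (proj₂ decY)
        eY : Y ≡ Y1 ++ [ e ] ++ Y2
        eY = proj₂ (proj₂ decY)
        leq : (X1 ++ (- e) ∷ X2) ++ Y1 ++ (- x) ∷ Y2 ≡ X1 ++ (- e) ∷ (X2 ++ Y1) ++ (- x) ∷ Y2
        leq = trans (LP.++-assoc X1 ((- e) ∷ X2) _) (cong (λ z → X1 ++ (- e) ∷ z) (sym (LP.++-assoc X2 Y1 _)))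
        r' : k ≤ cnt (X1 ++ (- e) ∷ (X2 ++ Y1) ++ (- x) ∷ Y2)
        r' = ℕP.≤-trans (lenX' (- e)) (ℕP.≤-trans (cnt-prefix (X1 ++ (- e) ∷ X2) _ (sm (- e) small)) (ℕP.≤-reflexive (cong cnt leq)))
        wEq : A ++ X ++ Y ≡ A ++ X1 ++ x ∷ (X2 ++ Y1) ++ e ∷ Y2
        wEq = cong (A ++_) (trans (cong₂ _++_ eX eY) (trans (LP.++-assoc X1 (x ∷ X2) _) (cong (λ z → X1 ++ x ∷ z) (sym (LP.++-assoc X2 Y1 _)))))

      sgX : ∀ {x} → x ∈ X → x ℤ.< 0ℤ → - x ℤ.≤ t → Reducible (A ++ X ++ Y)
      sgX {x} mx cond small = Reducible-subst (sym wEq) (inj₁ (mB-sg A X1 x (X2 ++ Y) cond lA r' (subst (IsSignedPerm n) wEq sp)))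
        where
        open Around mx
        r' : k ≤ cnt (X1 ++ (- x) ∷ X2 ++ Y)
        r' = ℕP.≤-trans (lenX' (- x)) (ℕP.≤-trans (cnt-prefix (X1 ++ (- x) ∷ X2) Y (sm (- x) small)) (ℕP.≤-reflexive (cong cnt (LP.++-assoc X1 ((- x) ∷ X2) Y))))
        wEq : A ++ X ++ Y ≡ A ++ X1 ++ x ∷ (X2 ++ Y)
        wEq = cong (A ++_) (trans (cong (_++ Y) eX) (LP.++-assoc X1 (x ∷ X2) Y))

      -- A negative value g ≤ t missing from X but above some x ∈ X: the value
      -- |g| is carried by a positive entry e = -g of A or of Y, and the signed
      -- transposition of e and x lowers w.
      negGap : ∀ {g x} → All (0ℤ ℤ.<_) A → All (0ℤ ℤ.<_) Y → x ∈ X → x ℤ.< g → g ℤ.< 0ℤ → g ℤ.≤ t →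
               (∀ {e} → e ∈ X → ∣ e ∣ ≢ ∣ g ∣) → Reducible (A ++ X ++ Y)
      negGap {g} {x} posA posY mx xg gneg gle notX = go (loc3 A X Y me)
        where
        fnd = SP-find sp (neg-abs≥1 gneg) (ℕP.≤-trans (ℕP.<⇒≤ (abs-lt-neg xg gneg)) (proj₂ (SP-range sp (inX A X Y mx))))
        e = proj₁ fnd
        me = proj₁ (proj₂ fnd)
        ae : ∣ e ∣ ≡ ∣ g ∣
        ae = proj₂ (proj₂ fnd)
        opposite : 0ℤ ℤ.< e → - e ≡ g
        opposite pe = trans (cong -_ (trans (pos-form pe) (cong +_ ae))) (sym (neg-form gneg))
        go : e ∈ A ⊎ e ∈ X ⊎ e ∈ Y → Reducible (A ++ X ++ Y)
        go (inj₁ ea) = swA ea mx (subst (x ℤ.<_) (sym ne) xg) (subst (ℤ._≤ t) (sym ne) gle)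
          where ne = opposite (All.lookup posA ea)
        go (inj₂ (inj₁ ex)) = ⊥-elim (notX ex ae)
        go (inj₂ (inj₂ ey)) = swY ey mx (flip< (subst (x ℤ.<_) (sym ne) xg)) (subst (ℤ._≤ t) (sym ne) gle)
          where ne = opposite (All.lookup posY ey)

  -- q > 0.  X has exactly k entries (else flip the sign of its least one),
  -- and they form the run -(q+k-1), ..., -q unless a gap gives a move.
  module PositiveQ (m k P Q' : ℕ) (Nn : bigN k (suc P) (+ suc Q') ≤ suc m) where
    q = + suc Q'
    open Reduction m k P q
    open Moves m k P q
    open Count t

    PkN : P + k ≤ bigN k (suc P) q
    PkN = ℕP.m≤m⊔n (P + k) (Q' + k)

    blockBound : ∀ {z} → z ∈ block k q → ∣ z ∣ ≤ bigN k (suc P) q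
    blockBound {z} mz with run-elem t k (subst (z ∈_) (blockP k Q') mz)
    ... | h1 , h2 = ℕP.≤-trans (ℕP.≤-pred (negbound (suc Q' + k) z (subst (ℤ._< z) (low-neg (suc Q') k) h1) (ℤP.≤-<-trans h2 ℤ.-<+)))
                       (ℕP.m≤n⊔m (P + k) (Q' + k))

    positiveSuffix : ∀ A X Y → IsSignedPerm n (A ++ X ++ Y) → length A ≡ P → k ≤ length X →
          Linked ℤ._<_ A → All (0ℤ ℤ.<_) A → Linked ℤ._<_ X → Linked ℤ._<_ Y →
          All (ℤ._≤ t) X → All (0ℤ ℤ.<_) Y → Reducible (A ++ X ++ Y)
    positiveSuffix A X Y sp lA r lkA posA lkX lkY aX posY with k ℕ.<? length X
    positiveSuffix A [] Y sp lA r lkA posA lkX lkY aX posY | yes ()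
    positiveSuffix A (x ∷ X') Y sp lA r lkA posA lkX lkY (ax ∷ aX') posY | yes gt =
      surplus A x X' Y sp lA gt (ℤP.≤-<-trans ax ℤ.-<+) aX'
    ... | no ngt with gap t X lkX aX
    ...   | inj₁ eXr = finish A X Y sp lA r lX aX (trans eXr (trans (cong (runU t) lX) (sym (blockP k Q')))) lkA posA lkY posY Nn PkN blockBound
      where
      lX : length X ≡ k
      lX = ℕP.≤-antisym (ℕP.≮⇒≥ ngt) r
    ...   | inj₂ (g , x , mx , xg , gle , ng) =
      GapMoves.At.negGap m k P q A X Y sp lA r aX posA posY mx xg gneg gle notX
      where
      gneg : g ℤ.< 0ℤ
      gneg = ℤP.≤-<-trans gle ℤ.-<+
      -- entries of X are negative, so one of absolute value |g| would be g
      notX : ∀ {e} → e ∈ X → ∣ e ∣ ≢ ∣ g ∣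
      notX ex ae = ng (subst (_∈ X) (trans (neg-form (ℤP.≤-<-trans (All.lookup aX ex) ℤ.-<+))
                     (trans (cong (λ z → - (+ z)) ae) (sym (neg-form gneg)))) ex)

    -- a negative entry of Y can change sign without affecting X
    core : SplitSuffix
    core A X [] sp lA r lkA posA lkX lkY aX aY = positiveSuffix A X [] sp lA r lkA posA lkX lkY aX []
    core A X (y ∷ Y') sp lA r lkA posA lkX lkY aX aY with 0ℤ ℤ.≤? y
    ... | no h = inj₁ (mB-sg A X y Y' (ℤP.≰⇒> h) lA (ℕP.≤-trans r (cnt-prefix X ((- y) ∷ Y') aX)) sp)
    ... | yes h = positiveSuffix A X (y ∷ Y') sp lA r lkA posA lkX lkY aX
                   (pos-of h lkY (λ mv → proj₁ (SP-range sp (inY A X (y ∷ Y') mv))))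

  -- q = -M < 0.  X splits into a negative part Xn ≤ -(M+1) and a positive
  -- part Xp ⊆ 1..M; each must be the corresponding run of block k q.
  module NegativeQ (m k P' M' : ℕ) (Nn : bigN k (suc (suc P')) -[1+ M' ] ≤ suc m) (MPk : suc M' < suc P' + k) where
    P = suc P'
    q = -[1+ M' ]
    M = suc M'
    open Reduction m k P q
    open Moves m k P q
    open Count t
    open GapMoves m k P q

    M≤n : M ≤ n
    M≤n = ℕP.≤-trans (ℕP.<⇒≤ MPk) Nn

    PkN : P + k ≤ bigN k (suc P) q
    PkN = ℕP.≤-refl

    module Parts (A Xn Xp Y : List ℤ) (sp : IsSignedPerm n (A ++ (Xn ++ Xp) ++ Y)) (lA : length A ≡ P)
              (r : k ≤ length (Xn ++ Xp)) (lkA : Linked ℤ._<_ A) (posA : All (0ℤ ℤ.<_) A)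
              (lkXn : Linked ℤ._<_ Xn) (lkXp : Linked ℤ._<_ Xp) (lkY : Linked ℤ._<_ Y)
              (aXn : All (ℤ._≤ - (+ suc M)) Xn) (aXp : All (ℤ._≤ + M) Xp) (posXp : All (0ℤ ℤ.<_) Xp)
              (aY : All (+ M ℤ.<_) Y) where
      X = Xn ++ Xp
      aX : All (ℤ._≤ t) X
      aX = AllP.++⁺ (All.map (λ h → ℤP.≤-trans h ℤ.-≤+) aXn) aXp
      posY : All (0ℤ ℤ.<_) Y
      posY = All.map (ℤP.<-trans (ℤ.+<+ (s≤s z≤n))) aY
      open At A X Y sp lA r aX
      inXn : ∀ {v} → v ∈ Xn → v ∈ X
      inXn = MP.∈-++⁺ˡ
      inXp : ∀ {v} → v ∈ Xp → v ∈ X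
      inXp = MP.∈-++⁺ʳ Xn

      locSmall : ∀ u → 1 ≤ u → u ≤ M → + u ∉ Xp → ∃ λ e → e ∈ A × e ≡ + u
      locSmall u h1 h2 nu with SP-find sp h1 (ℕP.≤-trans h2 M≤n)
      ... | e , me , ae with loc3 A X Y me
      ...   | inj₁ ea = e , ea , trans (pos-form (All.lookup posA ea)) (cong +_ ae)
      ...   | inj₂ (inj₂ ey) = ⊥-elim (ℕP.<-irrefl refl (ℕP.<-≤-trans (absPos> M (All.lookup aY ey)) (ℕP.≤-trans (ℕP.≤-reflexive ae) h2)))
      ...   | inj₂ (inj₁ ex) with MP.∈-++⁻ Xn ex
      ...     | inj₁ exn = ⊥-elim (ℕP.<-irrefl refl (ℕP.<-≤-trans (s≤s h2) (ℕP.≤-trans (absGE (suc M) (All.lookup aXn exn)) (ℕP.≤-reflexive ae))))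
      ...     | inj₂ exp = ⊥-elim (nu (subst (_∈ Xp) (trans (pos-form (All.lookup posXp exp)) (cong +_ ae)) exp))

      -- a gap g in the positive part: the value g sits in A (it is not in Xn or
      -- Y), and exchanging it with the entry x < g of Xp lowers w
      gapMove : Gap (+ M) Xp → Reducible (A ++ X ++ Y)
      gapMove (g , x , mxp , xg , gle , ng) with locSmall ∣ g ∣ (absPos1 gpos) (absPos≤ M gpos gle) (λ m' → ng (subst (_∈ Xp) (sym eg) m'))
        where
        gpos : 0ℤ ℤ.< g
        gpos = ℤP.<-trans (All.lookup posXp mxp) xg
        eg : g ≡ + ∣ g ∣
        eg = pos-form gpos
        absPos1 : ∀ {v} → 0ℤ ℤ.< v → 1 ≤ ∣ v ∣
        absPos1 (ℤ.+<+ p) = p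
      ... | e , ea , ee = trA ea (inXp mxp) (subst (x ℤ.<_) (trans (pos-form (ℤP.<-trans (All.lookup posXp mxp) xg)) (sym ee)) xg)
                            (subst (ℤ._≤ + M) (trans (pos-form (ℤP.<-trans (All.lookup posXp mxp) xg)) (sym ee)) gle)

      -- Xp a run shorter than M: the value M - |Xp| sits in A and can be
      -- exchanged with a negative entry x0 of Xn
      missLow : ∀ {x0} → x0 ∈ Xn → length Xp < M → Xp ≡ runU (+ M) (length Xp) → Reducible (A ++ X ++ Y)
      missLow {x0} mx0 lt eXp with locSmall (M ∸ length Xp) (ℕP.m<n⇒0<n∸m lt) (ℕP.m∸n≤m M (length Xp)) notin
        where
        notin : + (M ∸ length Xp) ∉ Xp
        notin mm = ℤP.<-irrefl (lowP M (length Xp) (ℕP.<⇒≤ lt))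
                     (proj₁ (run-elem (+ M) (length Xp) (subst (+ (M ∸ length Xp) ∈_) eXp mm)))
      ... | e , ea , ee = trA ea (inXn mx0)
            (subst (x0 ℤ.<_) (sym ee) (ℤP.<-≤-trans (ℤP.≤-<-trans (All.lookup aXn mx0) ℤ.-<+) (ℤ.+≤+ z≤n)))
            (subst (ℤ._≤ + M) (sym ee) (ℤ.+≤+ (ℕP.m∸n≤m M (length Xp))))

      negGapMove : Gap (- (+ suc M)) Xn → Reducible (A ++ X ++ Y)
      negGapMove (g , x , mxn , xg , gle , ng) =
        negGap posA posY (inXn mxn) xg gneg (ℤP.≤-trans (ℤP.<⇒≤ gneg) (ℤ.+≤+ z≤n)) notX
        where
        gneg : g ℤ.< 0ℤ
        gneg = ℤP.≤-<-trans gle ℤ.-<+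
        -- an entry of Xn of absolute value |g| would be g; those of Xp are too small
        notX : ∀ {e} → e ∈ X → ∣ e ∣ ≢ ∣ g ∣
        notX ex ae with MP.∈-++⁻ Xn ex
        ... | inj₁ exn = ng (subst (_∈ Xn) (trans (neg-form (ℤP.≤-<-trans (All.lookup aXn exn) ℤ.-<+))
                           (trans (cong (λ z → - (+ z)) ae) (sym (neg-form gneg)))) exn)
        ... | inj₂ exp = ℕP.<-irrefl refl (ℕP.<-≤-trans (s≤s (absPos≤ M (All.lookup posXp exp) (All.lookup aXp exp)))
                           (ℕP.≤-trans (absGE (suc M) gle) (ℕP.≤-reflexive (sym ae))))

    -- X = Xp is the run ending at M with more than k entries: then A, which is
    -- positive, increasing and avoids the run, cannot fit below it unless its
    -- last entry exceeds the head of Xp, giving a transposition.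
    positiveOnly : ∀ A Xp Y → IsSignedPerm n (A ++ Xp ++ Y) → length A ≡ P → k < length Xp →
         Linked ℤ._<_ A → All (0ℤ ℤ.<_) A → All (ℤ._≤ + M) Xp → All (0ℤ ℤ.<_) Xp →
         Xp ≡ runU (+ M) (length Xp) → Reducible (A ++ Xp ++ Y)
    positiveOnly A [] Y sp lA () lkA posA aXp posXp eXp
    positiveOnly A (h0 ∷ Xp') Y sp lA gt lkA posA (_ ∷ aXp') (h0pos ∷ _) eXp with lastView A
    ... | inj₁ refl = ⊥-elim (ℕP.0≢1+n lA)
    ... | inj₂ (A' , a , refl) with a ℤ.≤? h0
    ...   | no h = inj₁ (mX-tr A' a [] [] h0 (Xp' ++ Y) (ℤP.≰⇒> h) lA
                     (ℕP.≤-trans (ℕP.≤-pred gt) (ℕP.≤-trans (cnt-prefix Xp' Y aXp')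
                       (ℕP.≤-trans (ℕP.m≤n+m (cnt (Xp' ++ Y)) (ind a)) (ℕP.≤-reflexive (sym (cnt-∷ a (Xp' ++ Y))))))) sp)
    ...   | yes a≤h0 = ⊥-elim (ℕP.<-irrefl refl (ℕP.<-≤-trans MPk (ℕP.≤-trans (ℕP.+-monoʳ-≤ P (ℕP.≤-pred gt))
                          (ℕP.≤-trans (ℕP.+-monoʳ-≤ P (ℕP.n≤1+n ℓ')) Pbound))))
      where
      ℓ' = length Xp'
      eh : h0 ≡ low (+ M) ℓ'
      eh = LP.∷-injectiveˡ eXp
      ℓ'<M : ℓ' < M
      ℓ'<M = lowPos⇒lt M ℓ' (subst (0ℤ ℤ.<_) eh h0pos)
      h0v : h0 ≡ + (M ∸ ℓ')
      h0v = trans eh (lowP M ℓ' (ℕP.<⇒≤ ℓ'<M))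
      a<h0 : a ℤ.< h0
      a<h0 = ℤP.≤∧≢⇒< a≤h0 (disAX (A' ++ [ a ]) (h0 ∷ Xp') Y (SP-dis sp) (MP.∈-++⁺ʳ A' (here refl)) (here refl))
      bnd : ∀ {v} → 0ℤ ℤ.< v → v ℤ.< + (M ∸ ℓ') → + 0 ℤ.< v × v ℤ.≤ + (M ∸ suc ℓ')
      bnd {+ v'} (ℤ.+<+ p) (ℤ.+<+ q') = ℤ.+<+ p , ℤ.+≤+ (subst (v' ≤_) (ℕP.pred[m∸n]≡m∸[1+n] M ℓ') (ℕP.<⇒≤pred q'))
      allb : All (λ v → + 0 ℤ.< v × v ℤ.≤ + (M ∸ suc ℓ')) (A' ++ [ a ])
      allb = All.tabulate λ {v} mv → bnd (All.lookup posA mv)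
               (subst (v ℤ.<_) h0v (ℤP.≤-<-trans (All.lookup (last-max A' a lkA) mv) a<h0))
      Pbound : P + suc ℓ' ≤ M
      Pbound = ℕP.≤-trans (ℕP.+-monoˡ-≤ (suc ℓ') (subst (_≤ M ∸ suc ℓ') lA (count-bound 0 (M ∸ suc ℓ') (A' ++ [ a ]) lkA allb)))
                 (ℕP.≤-reflexive (ℕP.m∸n+n≡m ℓ'<M))

    blockBound₁ : suc M' < k → ∀ {z} → z ∈ block k q → ∣ z ∣ ≤ bigN k (suc P) q
    blockBound₁ kgt {z} mz with MP.∈-++⁻ (runU (- (+ suc M)) (k ∸ M)) (subst (z ∈_) (blockN1 k M' kgt) mz)
    ... | inj₁ m1 with run-elem (- (+ suc M)) (k ∸ M) m1
    ...   | h1 , h2 = ℕP.≤-trans (ℕP.≤-pred (ℕP.<-≤-trans (negbound (suc M + (k ∸ M)) z (subst (ℤ._< z) (low-neg (suc M) (k ∸ M)) h1) (ℤP.≤-<-trans h2 ℤ.-<+))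
                          (ℕP.≤-reflexive (cong suc (ℕP.m+[n∸m]≡n (ℕP.<⇒≤ kgt))))))
                       (ℕP.m≤n+m k P)
    blockBound₁ kgt {z} mz | inj₂ m2 with run-elem (+ M) M m2
    ... | h1 , h2 = ℕP.≤-trans (absPos≤ M (ℤP.≤-<-trans (ℤP.≤-reflexive (sym (trans (lowP M M ℕP.≤-refl) (cong +_ (ℕP.n∸n≡0 M))))) h1) h2)
                      (ℕP.≤-trans (ℕP.<⇒≤ MPk) ℕP.≤-refl)

    blockBound₂ : ¬ (suc M' < k) → ∀ {z} → z ∈ block k q → ∣ z ∣ ≤ bigN k (suc P) q
    blockBound₂ kle {z} mz with run-elem (+ M) k (subst (z ∈_) (blockN2 k M' kle) mz)
    ... | h1 , h2 = ℕP.≤-trans (absPos≤ M (ℤP.≤-<-trans (subst (0ℤ ℤ.≤_) (sym (lowP M k (ℕP.≮⇒≥ kle))) (ℤ.+≤+ z≤n)) h1) h2)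
                      (ℕP.<⇒≤ MPk)

    twoParts : ∀ A Xn Xp Y → IsSignedPerm n (A ++ (Xn ++ Xp) ++ Y) → length A ≡ P → k ≤ length (Xn ++ Xp) →
          Linked ℤ._<_ A → All (0ℤ ℤ.<_) A → Linked ℤ._<_ Xn → Linked ℤ._<_ Xp → Linked ℤ._<_ Y →
          All (ℤ._≤ - (+ suc M)) Xn → All (ℤ._≤ + M) Xp → All (0ℤ ℤ.<_) Xp → All (+ M ℤ.<_) Y →
          Reducible (A ++ (Xn ++ Xp) ++ Y)
    twoParts A Xn Xp Y sp lA r lkA posA lkXn lkXp lkY aXn aXp posXp aY with k ℕ.<? length (Xn ++ Xp)
    twoParts A (x ∷ Xn') Xp Y sp lA r lkA posA lkXn lkXp lkY (ax ∷ aXn') aXp posXp aY | yes gt =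
      surplus A x (Xn' ++ Xp) Y sp lA gt (ℤP.≤-<-trans ax ℤ.-<+) (AllP.++⁺ (All.map (λ h → ℤP.≤-trans h ℤ.-≤+) aXn') aXp)
    twoParts A [] Xp Y sp lA r lkA posA lkXn lkXp lkY aXn aXp posXp aY | yes gt with gap (+ M) Xp lkXp aXp
    ... | inj₂ gp = Parts.gapMove A [] Xp Y sp lA r lkA posA lkXn lkXp lkY aXn aXp posXp aY gp
    ... | inj₁ eXp = positiveOnly A Xp Y sp lA gt lkA posA aXp posXp eXp
    twoParts A Xn Xp Y sp lA r lkA posA lkXn lkXp lkY aXn aXp posXp aY | no ngt with gap (+ M) Xp lkXp aXp
    ... | inj₂ gp = Parts.gapMove A Xn Xp Y sp lA r lkA posA lkXn lkXp lkY aXn aXp posXp aY gp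
    ... | inj₁ eXp = exactLength (ℕP.≤-antisym (ℕP.≮⇒≥ ngt) r)
      where
      module parts = Parts A Xn Xp Y sp lA r lkA posA lkXn lkXp lkY aXn aXp posXp aY
      isBlock : Xn ++ Xp ≡ block k q → length (Xn ++ Xp) ≡ k → (∀ {z} → z ∈ block k q → ∣ z ∣ ≤ bigN k (suc P) q) → Reducible (A ++ (Xn ++ Xp) ++ Y)
      isBlock eXb lX ub = finish A (Xn ++ Xp) Y sp lA r lX parts.aX eXb lkA posA lkY parts.posY Nn PkN ub
      -- k > M: Xp must be the full run 1..M and Xn the run of the k - M
      -- remaining entries ending at -(M+1)
      longBlock : suc M' < k → length (Xn ++ Xp) ≡ k → Reducible (A ++ (Xn ++ Xp) ++ Y)
      longBlock kgt lX with length Xp ℕ.<? M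
      ...   | yes ℓlt = viaNegativeEntry Xn refl
        where
        viaNegativeEntry : ∀ Z → Z ≡ Xn → Reducible (A ++ (Xn ++ Xp) ++ Y)
        viaNegativeEntry [] e = ⊥-elim (ℕP.<-irrefl refl (ℕP.<-trans ℓlt (ℕP.<-≤-trans kgt (ℕP.≤-reflexive (sym (trans (cong (λ z → length (z ++ Xp)) e) lX))))))
        viaNegativeEntry (x0 ∷ _) e = parts.missLow (subst (x0 ∈_) e (here refl)) ℓlt eXp
      ...   | no ℓge with gap (- (+ suc M)) Xn lkXn aXn
      ...     | inj₂ gp = parts.negGapMove gp
      ...     | inj₁ eXn = isBlock eXb lX (blockBound₁ kgt)
        where
        ℓ≤M : length Xp ≤ M
        ℓ≤M = runLen≤ M Xp eXp posXp
        ℓ≡M : length Xp ≡ M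
        ℓ≡M = ℕP.≤-antisym ℓ≤M (ℕP.≮⇒≥ ℓge)
        lXn : length Xn ≡ k ∸ M
        lXn = trans (sym (ℕP.m+n∸n≡m (length Xn) M)) (cong (_∸ M) (trans (cong (λ z → length Xn ℕ.+ z) (sym ℓ≡M)) (trans (sym (LP.length-++ Xn)) lX)))
        eXb : Xn ++ Xp ≡ block k q
        eXb = trans (cong₂ _++_ (trans eXn (cong (runU (- (+ suc M))) lXn)) (trans eXp (cong (runU (+ M)) ℓ≡M))) (sym (blockN1 k M' kgt))
      -- k ≤ M: Xn must be empty and Xp the run of k entries ending at M
      shortBlock : ¬ (suc M' < k) → length (Xn ++ Xp) ≡ k → Reducible (A ++ (Xn ++ Xp) ++ Y)
      shortBlock kle lX = viaNegativePart Xn refl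
        where
        lX2 : length Xn + length Xp ≡ k
        lX2 = trans (sym (LP.length-++ Xn)) lX
        viaNegativePart : ∀ Z → Z ≡ Xn → Reducible (A ++ (Xn ++ Xp) ++ Y)
        viaNegativePart (x0 ∷ Z') e = parts.missLow (subst (x0 ∈_) e (here refl))
          (ℕP.<-≤-trans (ℕP.<-≤-trans (s≤s (ℕP.m≤n+m (length Xp) (length Z')))
             (ℕP.≤-reflexive (trans (cong (λ z → length z ℕ.+ length Xp) e) lX2))) (ℕP.≮⇒≥ kle)) eXp
        viaNegativePart [] e = isBlock eXb lX (blockBound₂ kle)
          where
          lXp : length Xp ≡ k
          lXp = trans (cong (λ z → length z ℕ.+ length Xp) e) lX2
          eXb : Xn ++ Xp ≡ block k q
          eXb = trans (cong (_++ Xp) (sym e)) (trans eXp (trans (cong (runU (+ M)) lXp) (sym (blockN2 k M' kle))))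
      exactLength : length (Xn ++ Xp) ≡ k → Reducible (A ++ (Xn ++ Xp) ++ Y)
      exactLength lX = byBlockShape (suc M' ℕ.<? k)
        where
        -- (a plain `with` would also abstract the test inside block k q)
        byBlockShape : Dec (suc M' < k) → Reducible (A ++ (Xn ++ Xp) ++ Y)
        byBlockShape (yes kgt) = longBlock kgt lX
        byBlockShape (no kle) = shortBlock kle lX

    -- an entry of X in [-M, -1] can change sign; otherwise X splits into the
    -- parts Xn ≤ -(M+1) and 0 < Xp ≤ M
    core : SplitSuffix
    core A X Y sp lA r lkA posA lkX lkY aX aY with Any.any? (λ v → (v ℤ.<? 0ℤ) ×-dec (- (+ M) ℤ.≤? v)) X
    ... | yes an with find an
    ...   | x , mx , (xn , xge) = At.sgX A X Y sp lA r aX mx xn (ℤP.neg-mono-≤ xge)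
    core A X Y sp lA r lkA posA lkX lkY aX aY | no nan with split (-[1+ 0 ]) X (lk≤ lkX)
    ... | Xn , Xp , eXs , aXn1 , aXp1 =
      Reducible-subst (cong (λ z → A ++ z ++ Y) (sym eXs))
        (twoParts A Xn Xp Y (subst (λ z → IsSignedPerm n (A ++ z ++ Y)) eXs sp) lA (subst (λ z → k ≤ length z) eXs r) lkA posA
          (lk-++ˡ Xn lkX') (lk-++ʳ Xn lkX') lkY aXn (AllP.++⁻ʳ Xn aX') posXp aY)
      where
      lkX' = subst (Linked ℤ._<_) eXs lkX
      aX' = subst (All (ℤ._≤ t)) eXs aX
      nA : All (λ v → ¬ ((v ℤ.< 0ℤ) × (- (+ M) ℤ.≤ v))) (Xn ++ Xp)
      nA = subst (All (λ v → ¬ ((v ℤ.< 0ℤ) × (- (+ M) ℤ.≤ v)))) eXs (AllP.¬Any⇒All¬ X nan)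
      aXn : All (ℤ._≤ - (+ suc M)) Xn
      aXn = All.zipWith (λ (h , nh) → ℤP.i<j⇒i≤pred[j] (ℤP.≰⇒> λ le → nh (ℤP.≤-<-trans h ℤ.-<+ , le))) (aXn1 , AllP.++⁻ˡ Xn nA)
      posXp : All (0ℤ ℤ.<_) Xp
      posXp = All.tabulate λ {v} mv → nonzero-pos (gt-1 (All.lookup aXp1 mv))
                (proj₁ (SP-range sp (inX A X Y (subst (v ∈_) (sym eXs) (MP.∈-++⁺ʳ Xn mv)))))

  reduceSorted : ∀ m k P q → Reduction.SplitSuffix m k P q → P ≤ suc m → ∀ w → IsSignedPerm (suc m) w → k ≤ rank w (suc P) q → Reduction.Reducible m k P q w
  reduceSorted m k P q core Pn w sp r =
    Reduction.Reducible-subst m k P q (LP.take++drop≡id P w)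
      (Reduction.sortPrefix m k P q (take P w) (drop P w) (subst (IsSignedPerm (suc m)) (sym (LP.take++drop≡id P w)) sp) lA r (Reduction.splitSuffix m k P q core))
    where
    lA : length (take P w) ≡ P
    lA = trans (LP.length-take P w) (ℕP.m≤n⇒m⊓n≡m (subst (P ≤_) (sym (proj₁ sp)) Pn))

  -- for q = -(M'+1) < 0, the triple condition k > 1 - p - q reads |q| < p + k - 1
  negq-bound : ∀ P' M' k → suc M' ℤ.⊖ suc P' ℤ.< + k → suc M' < suc P' ℕ.+ k
  negq-bound P' M' k h with suc P' ℕ.≤? suc M'
  ... | yes le = ℕP.≤-trans (ℕP.≤-reflexive (sym (trans (ℕP.+-suc (suc P') (suc M' ∸ suc P')) (cong suc (ℕP.m+[n∸m]≡n le)))))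
                   (ℕP.+-monoʳ-≤ (suc P') (ℤP.drop‿+<+ (subst (ℤ._< + k) (ℤP.⊖-≥ le) h)))
  ... | no nle = ℕP.≤-trans (ℕP.≰⇒> nle) (ℕP.m≤m+n (suc P') k)

  reduction : ∀ m k P q → BasicTriple k (suc P) q → bigN k (suc P) q ≤ suc m →
    ∀ w → IsSignedPerm (suc m) w → k ≤ rank w (suc P) q → Reduction.Reducible m k P q w
  reduction m k P (+ zero) bt N≤n w sp r = ⊥-elim (BasicTriple.q≢0 bt refl)
  reduction m k P (+ suc Q') bt N≤n = reduceSorted m k P (+ suc Q') (PositiveQ.core m k P Q' N≤n)
    (ℕP.≤-trans (ℕP.≤-trans (ℕP.m≤m+n P k) (ℕP.m≤m⊔n (P + k) (Q' + k))) N≤n)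
  reduction m k zero -[1+ M' ] bt N≤n w sp r with BasicTriple.p≡1⇒q>0 bt refl
  ... | ()
  reduction m k (suc P') -[1+ M' ] bt N≤n = reduceSorted m k (suc P') -[1+ M' ] (NegativeQ.core m k P' M' N≤n MPk)
    (ℕP.≤-trans (ℕP.m≤m+n (suc P') k) N≤n)
    where
    MPk = negq-bound P' M' k (BasicTriple.k>1-p-q bt)

  module Descent (m k P : ℕ) (q : ℤ) (step : ∀ w → IsSignedPerm (suc m) w → k ≤ rank w (suc P) q → Reduction.Reducible m k P q w) where
    n = suc m
    b = basic n k (suc P) q

    Goal : List ℤ → Set
    Goal w = IsSignedPerm n b × k ≤ rank b (suc P) q × BruhatLe n b w

    descend-from : ∀ f w → inv w < f → IsSignedPerm n w → k ≤ rank w (suc P) q → Goal w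
    descend-from (suc f) w lt sp r with step w sp r
    ... | inj₂ refl = sp , r , ε
    ... | inj₁ (w' , sp' , r' , st , lt') with descend-from f w' (ℕP.<-≤-trans lt' (ℕP.≤-pred lt)) sp' r'
    ...   | spb , rb , le = spb , rb , (le ◅◅ (st ◅ ε))

    descend : ∀ w → IsSignedPerm n w → k ≤ rank w (suc P) q → Goal w
    descend w sp r = descend-from (suc (inv w)) w (ℕP.n<1+n (inv w)) sp r

  negℕ : ℕ → ℤ
  negℕ i = - (+ i)

  longest : ℕ → List ℤ
  longest n = map negℕ (upFrom 1 n)

  longest-SP : ∀ n → IsSignedPerm n (longest n)
  longest-SP n = trans (LP.length-map negℕ (upFrom 1 n)) (length-upFrom 1 n) ,
    subst (λ z → map ∣_∣ (longest n) Pm.↭ z) (sym (range-eq 1 n))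
      (Pm.↭-reflexive (trans (sym (LP.map-∘ (upFrom 1 n))) (trans (LP.map-cong (λ i → ℤP.∣-i∣≡∣i∣ (+ i)) (upFrom 1 n)) (LP.map-id (upFrom 1 n)))))

  -- w₀ has rank ≥ k, since its last k entries are ≤ -(n-k+1) ≤ -q
  longest-rank-suffix : ∀ n k P q → P + k ≤ n → q ℤ.≤ + suc (n ∸ k) → k ≤ rank (longest n) (suc P) q
  longest-rank-suffix n k P q Pk qa = goal
    where
    open Count (- q)
    d = n ∸ P ∸ k
    kle : k ≤ n ∸ P
    kle = subst (_≤ n ∸ P) (ℕP.m+n∸m≡n P k) (ℕP.∸-monoˡ-≤ P Pk)
    e1 : n ∸ P ≡ d + k
    e1 = sym (ℕP.m∸n+n≡m kle)
    aeq : suc P + d ≡ suc (n ∸ k)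
    aeq = cong suc (ℕP.+-cancelʳ-≡ k (P + d) (n ∸ k)
            (trans (ℕP.+-assoc P d k) (trans (cong (λ z → P ℕ.+ z) (sym e1)) (trans (ℕP.m+[n∸m]≡n (ℕP.≤-trans (ℕP.m≤m+n P k) Pk)) (sym (ℕP.m∸n+n≡m (ℕP.≤-trans (ℕP.m≤n+m k P) Pk)))))))
    ys = upFrom (suc P + d) k
    smallYs : All (ℤ._≤ - q) (map negℕ ys)
    smallYs = All.tabulate λ {v} mv → lem mv
      where
      lem : ∀ {v} → v ∈ map negℕ ys → v ℤ.≤ - q
      lem mv with MP.∈-map⁻ negℕ mv
      ... | i , mi , refl = ℤP.neg-mono-≤ (ℤP.≤-trans qa (ℤ.+≤+ (subst (_≤ i) aeq (proj₁ (∈-upFrom⁻ (suc P + d) k mi)))))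
    dropEq : drop P (longest n) ≡ map negℕ (upFrom (suc P) d) ++ map negℕ ys
    dropEq = trans (LP.drop-map P (upFrom 1 n)) (trans (cong (map negℕ) (trans (drop-upFrom P 1 n) (trans (cong (upFrom (suc P)) e1) (upFrom-++ (suc P) d k)))) (LP.map-++ negℕ (upFrom (suc P) d) ys))
    goal : k ≤ rank (longest n) (suc P) q
    goal = subst (k ≤_) (sym (cong cnt dropEq))
      (ℕP.≤-trans (ℕP.≤-reflexive (sym (trans (LP.length-map negℕ ys) (length-upFrom _ k))))
        (ℕP.≤-trans (ℕP.≤-reflexive (sym (cnt-all (map negℕ ys) smallYs)))
          (ℕP.≤-trans (ℕP.m≤n+m (cnt (map negℕ ys)) (cnt (map negℕ (upFrom (suc P) d)))) (ℕP.≤-reflexive (sym (cnt-++ (map negℕ (upFrom (suc P) d)) (map negℕ ys)))))))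

  bigN-bound : ∀ k P q m → BasicTriple k (suc P) q →
    + suc P ℤ.+ + k ℤ.- + 1 ℤ.≤ + suc m → q ℤ.+ + k ℤ.- + 1 ℤ.≤ + suc m → bigN k (suc P) q ≤ suc m
  bigN-bound k P (+ zero) m bt hp hq = ⊥-elim (BasicTriple.q≢0 bt refl)
  bigN-bound k P (+ suc Q') m bt (ℤ.+≤+ hp) (ℤ.+≤+ hq) = ℕP.⊔-lub hp hq
  bigN-bound k P -[1+ M' ] m bt (ℤ.+≤+ hp) hq = hp

  longest-rank : ∀ m k P q → bigN k (suc P) q ≤ suc m → k ≤ rank (longest (suc m)) (suc P) q
  longest-rank m k P (+ zero) N≤n =
    longest-rank-suffix (suc m) k P (+ zero) (ℕP.≤-trans (ℕP.m≤m⊔n (P + k) _) N≤n) (ℤ.+≤+ z≤n)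
  longest-rank m k P (+ suc Q') N≤n =
    longest-rank-suffix (suc m) k P (+ suc Q') (ℕP.≤-trans (ℕP.m≤m⊔n (P + k) _) N≤n)
      (ℤ.+≤+ (s≤s (subst (_≤ suc m ∸ k) (ℕP.m+n∸n≡m Q' k) (ℕP.∸-monoˡ-≤ k (ℕP.≤-trans (ℕP.m≤n⊔m (P + k) _) N≤n)))))
  longest-rank m k P -[1+ M' ] N≤n = longest-rank-suffix (suc m) k P -[1+ M' ] N≤n ℤ.-≤+

open import Data.Nat using (ℕ; suc; zero; _≤_)
open import Data.Integer using (ℤ; +_; _+_; _-_)
open import Data.Product using (_×_; _,_; proj₁; proj₂)
open import Data.List using (List)
open import Data.Empty using (⊥-elim)
open import Relation.Binary.PropositionalEquality using (refl)
import Data.Nat.Properties as ℕP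
import Data.Integer as ℤ
open Minimality using (module Descent; reduction; bigN-bound; longest; longest-SP; longest-rank)

-- The theorem.  p > 0 and n ≥ k > 0, so p = P + 1 and n = m + 1.  Descending
-- from the longest element gives the properties of w(k,p,q) itself;
-- descending from w gives w(k,p,q) ≤ w.
lemma2p5 : (k p : ℕ) (q : ℤ) → BasicTriple k p q → (n : ℕ)
    → + p + + k - + 1 Data.Integer.≤ + n → q + + k - + 1 Data.Integer.≤ + n
    → IsSignedPerm n (basic n k p q)
    × k ≤ rank (basic n k p q) p q
    × ((w : List ℤ) → IsSignedPerm n w → k ≤ rank w p q → BruhatLe n (basic n k p q) w)
lemma2p5 k zero q bt n hp hq = ⊥-elim (ℕP.<-irrefl refl (BasicTriple.p>0 bt))
lemma2p5 k (suc P) q bt zero (ℤ.+≤+ hp) hq =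
  ⊥-elim (ℕP.<-irrefl refl (ℕP.<-≤-trans (BasicTriple.k>0 bt) (ℕP.≤-trans (ℕP.m≤n+m k P) hp)))
lemma2p5 k (suc P) q bt (suc m) hp hq =
  proj₁ fromLongest , proj₁ (proj₂ fromLongest) , λ w sp r → proj₂ (proj₂ (descend w sp r))
  where
  N≤n = bigN-bound k P q m bt hp hq
  open Descent m k P q (reduction m k P q bt N≤n) using (descend)
  fromLongest = descend (longest (suc m)) (longest-SP (suc m)) (longest-rank m k P q N≤n)
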